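{- Let $\ell\geq0$ and $b\geq2$ be integers. Let $G$ be a multigraph with $n\geq (3\ell+1) b$ vertices. Let $(T,\{ B_z : z \in V(T) \})$ be a tree decomposition of $G$ such that $T$ has maximum degree at most 3 and $|B_z|\leq b$ for each $z\in V(T)$. Then there is a set $R$ of exactly $\ell$ edges of $T$ such that for each of the $\ell+1$ components $Q$ of $T-R$, $$|G[Q]|\geq \frac{n-\ell b}{2\ell+1}.$$
   Context: A tree decomposition of a multigraph $G$ is a pair $(T,\{B_z:z\in V(T)\})$ consisting of a tree $T$ and sets $B_z\subseteq V(G)$ (bags) indexed by the nodes of $T$ such that: (1) $\bigcup_{z} B_z=V(G)$; (2) for every edge $vw$ of $G$ some bag contains both $v$ and $w$; (3) for every vertex $v$ of $G$, the set $\{z\in V(T):v\in B_z\}$ induces a non-empty connected subtree of $T$. For a subtree $Q$ of $T$, $G[Q]$ denotes the subgraph of $G$ induced by $\bigcup\{B_z:z\in V(Q)\}\setminus\bigcup\{B_z:z\in V(T)\setminus V(Q)\}$, i.e. the vertices lying in some bag of $Q$ and in no bag outside $Q$; $|G[Q]|$ is its number of vertices. -}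

module Defs where

open import Data.Nat using (ℕ; suc; _≤_; _*_; _+_; _∸_)
open import Data.Bool using (Bool; true; false)
open import Data.Fin using (Fin)
open import Data.Fin.Subset using (Subset; _∈_; ∣_∣)
open import Data.List using (List; []; _∷_; _++_; [_]; length; filterᵇ; allFin)
open import Data.List.Relation.Unary.All using (All)
open import Data.List.Relation.Unary.Any using (Any)
open import Data.List.Relation.Unary.AllPairs using (AllPairs)
open import Data.List.Relation.Unary.Linked using (Linked)
open import Data.List.Relation.Unary.Unique.Propositional using (Unique)
open import Data.Product using (Σ; ∃; _×_; _,_)
open import Data.Sum using (_⊎_)
open import Relation.Binary.PropositionalEquality using (_≡_)
open import Relation.Binary.Construct.Closure.ReflexiveTransitive using (Star)
open import Relation.Nullary using (¬_)

Adj : ℕ → Set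
Adj m = Fin m → Fin m → Bool

E : ∀ {m} → Adj m → Fin m → Fin m → Set
E adj i j = adj i j ≡ true

IsSimple : ∀ {m} → Adj m → Set
IsSimple {m} adj = (∀ (i j : Fin m) → adj i j ≡ adj j i) × (∀ (i : Fin m) → adj i i ≡ false)

degree : ∀ {m} → Adj m → Fin m → ℕ
degree {m} adj i = length (filterᵇ (adj i) (allFin m))

Connected : ∀ {m} → Adj m → Set
Connected {m} adj = ∀ (i j : Fin m) → Star (E adj) i j

HasCycle : ∀ {m} → Adj m → Set
HasCycle {m} adj =
  Σ (Fin m) λ a → Σ (List (Fin m)) λ rest →
    (2 ≤ length rest) × Unique (a ∷ rest) × Linked (E adj) (a ∷ rest ++ [ a ])

IsTree : ∀ {m} → Adj m → Set
IsTree {m} adj = (1 ≤ m) × IsSimple adj × Connected adj × ¬ HasCycle adj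

-- Multigraph on vertex set Fin n: a list of edges (loops and parallel
-- edges allowed).

Multigraph : ℕ → Set
Multigraph n = List (Fin n × Fin n)

IsTreeDecomposition : ∀ {n m} → Multigraph n → Adj m → (Fin m → Subset n) → Set
IsTreeDecomposition {n} {m} G adj B =
  IsTree adj
  × (∀ (v : Fin n) → ∃ λ (z : Fin m) → v ∈ B z)
  × All (λ e → ∃ λ (z : Fin m) → (Data.Product.proj₁ e ∈ B z) × (Data.Product.proj₂ e ∈ B z)) G
  × (∀ (v : Fin n) (z z' : Fin m) → v ∈ B z → v ∈ B z' →
       Star (λ x y → E adj x y × v ∈ B x × v ∈ B y) z z')

SameEdge : ∀ {m} → (Fin m × Fin m) → (Fin m × Fin m) → Set
SameEdge (a , b) (c , d) = ((a ≡ c) × (b ≡ d)) ⊎ ((a ≡ d) × (b ≡ c))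

IsEdgeSetOfSize : ∀ {m} → Adj m → ℕ → List (Fin m × Fin m) → Set
IsEdgeSetOfSize adj ℓ R =
  (length R ≡ ℓ)
  × All (λ e → E adj (Data.Product.proj₁ e) (Data.Product.proj₂ e)) R
  × AllPairs (λ e e' → ¬ SameEdge e e') R

E-minus : ∀ {m} → Adj m → List (Fin m × Fin m) → Fin m → Fin m → Set
E-minus adj R i j = E adj i j × ¬ Any (SameEdge (i , j)) R

InComponent : ∀ {m} → Adj m → List (Fin m × Fin m) → Fin m → Fin m → Set
InComponent adj R z z' = Star (E-minus adj R) z z'

-- vertex set of G[Q] for a subtree (predicate on nodes) Q:
-- v lies in some bag of Q and in no bag outside Q
InGQ : ∀ {n m} → (Fin m → Subset n) → (Fin m → Set) → Fin n → Set
InGQ {n} {m} B Q v = (∃ λ (z : Fin m) → Q z × v ∈ B z) × (∀ (z : Fin m) → v ∈ B z → Q z)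

AtLeastVerts : ∀ {n m} → (Fin m → Subset n) → (Fin m → Set) → (ℕ → Set) → Set
AtLeastVerts {n} B Q bound =
  Σ (List (Fin n)) λ L → Unique L × All (InGQ B Q) L × bound (length L)

module Submission where

-- Root T (breadth-first search); since T is a tree, every edge then
-- joins a node z to its parent p z.  Charge each vertex of G to its top node,
-- the highest node whose bag contains it; let c z count the vertices charged
-- to z and β z = |B z ∩ B (p z)|, so c z + β z ≤ b.  Cutting the edges
-- z p(z) for z in a cut set X splits T into pieces, each headed by its
-- highest node.  A piece owns every vertex charged inside it except those
-- in the adhesion β of a cut edge hanging below it, so its size is at least
-- its mass (sum of c) minus its boundary (sum of β over hanging cut nodes).
-- Let s = ⌊(n − ℓb − 1)/(2ℓ+1)⌋.  Greedily, ℓ times, cut off a deepest node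
-- x of the root piece whose part of the root piece has mass − boundary > s.
-- Its (at most 2) children do not qualify, so the root piece loses at most
-- b + 2s; and while fewer than ℓ cuts are made some node qualifies, since
-- otherwise the root piece (at most 3 children) would be smaller than
-- n ≥ (3ℓ+1)b allows.  In the end every piece has size > s, and
-- (2ℓ+1)(s+1) ≥ n − ℓb.

open import Defs
open import Data.Nat using (ℕ; _≤_; _*_; _+_; _∸_)
open import Data.Fin using (Fin)
open import Data.Fin.Subset using (Subset; ∣_∣)
open import Data.List using (List)
open import Data.Product using (Σ; _×_)

open import Data.Bool using (T; true) renaming (_≟_ to _≟B_)
open import Data.Empty using (⊥; ⊥-elim)
open import Data.Fin using (zero; suc; toℕ; fromℕ<)
open import Data.Fin.Properties using (any?; toℕ-fromℕ<; toℕ≤pred[n])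
  renaming (_≟_ to _≟F_; suc-injective to Fin-suc-injective)
open import Data.Fin.Subset using (inside; outside) renaming (_∈_ to _∈ₛ_)
open import Data.Fin.Subset.Properties using () renaming (_∈?_ to _∈ₛ?_)
open import Data.List using ([]; _∷_; _++_; [_]; length; filter; tabulate; map; allFin)
open import Data.List.Properties using (length-++; length-map)
open import Data.List.Membership.Propositional using (_∈_; _∉_; find)
import Data.List.Membership.DecPropositional as DecMembership
open import Data.List.Relation.Unary.All as All using (All; []; _∷_)
import Data.List.Relation.Unary.All.Properties as Allₚ
open import Data.List.Relation.Unary.Any as Any using (here; there)
import Data.List.Relation.Unary.Any.Properties as Anyₚ
open import Data.List.Relation.Unary.AllPairs as AllPairs using ([]; _∷_)
import Data.List.Relation.Unary.AllPairs.Properties as AllPairsₚ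
open import Data.List.Relation.Unary.Linked using (Linked; []; [-]; _∷_)
open import Data.List.Relation.Unary.Unique.Propositional using (Unique)
import Data.List.Relation.Unary.Unique.Propositional.Properties as Uniqueₚ
open import Data.Nat using (zero; suc; _<_; z≤n; s≤s; _≤?_)
open import Data.Nat.DivMod using (_/_; _%_; m/n*n≤m; m≡m%n+[m/n]*n; m%n<n)
open import Data.Nat.Properties
open import Algebra.Properties.CommutativeMonoid.Sum +-0-commutativeMonoid
  using (sum; ∑-distrib-+; ∑-comm; sum-cong-≗; sum-replicate-zero)
open import Data.Nat.Tactic.RingSolver using (solve-∀)
open import Data.Product using (∃; _,_; proj₁; proj₂)
open import Data.Sum using (_⊎_; inj₁; inj₂)
open import Data.Unit using (tt)
import Data.Vec as Vec
open import Function using (_∘_)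
open import Relation.Binary.Construct.Closure.ReflexiveTransitive using (Star; ε; _◅_; _◅◅_)
import Relation.Binary.Construct.Closure.ReflexiveTransitive as Star
open import Relation.Binary.Definitions using (tri<; tri≈; tri>)
open import Relation.Binary.PropositionalEquality hiding ([_])
open import Relation.Nullary using (Dec; yes; no; ¬_)
open import Relation.Nullary.Decidable using (¬?; _×-dec_; _⊎-dec_; T?)

⟦_⟧ : ∀ {p} {P : Set p} → Dec P → ℕ
⟦ yes _ ⟧ = 1
⟦ no _ ⟧ = 0

⟦⟧-yes : ∀ {p} {P : Set p} (P? : Dec P) → P → ⟦ P? ⟧ ≡ 1
⟦⟧-yes (yes _) _ = refl
⟦⟧-yes (no ¬p) p = ⊥-elim (¬p p)

⟦⟧-no : ∀ {p} {P : Set p} (P? : Dec P) → ¬ P → ⟦ P? ⟧ ≡ 0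
⟦⟧-no (yes p) ¬p = ⊥-elim (¬p p)
⟦⟧-no (no _) _ = refl

⟦⟧≤1 : ∀ {p} {P : Set p} (P? : Dec P) → ⟦ P? ⟧ ≤ 1
⟦⟧≤1 (yes _) = s≤s z≤n
⟦⟧≤1 (no _) = z≤n

⟦⟧-mono : ∀ {p q} {P : Set p} {Q : Set q} (P? : Dec P) (Q? : Dec Q) → (P → Q) → ⟦ P? ⟧ ≤ ⟦ Q? ⟧
⟦⟧-mono (yes p) (yes q) f = ≤-refl
⟦⟧-mono (yes p) (no ¬q) f = ⊥-elim (¬q (f p))
⟦⟧-mono (no ¬p) Q? f = z≤n

⟦⟧-iff : ∀ {p q} {P : Set p} {Q : Set q} (P? : Dec P) (Q? : Dec Q) → (P → Q) → (Q → P) → ⟦ P? ⟧ ≡ ⟦ Q? ⟧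
⟦⟧-iff P? Q? f g = ≤-antisym (⟦⟧-mono P? Q? f) (⟦⟧-mono Q? P? g)

⟦×⟧ : ∀ {p q} {P : Set p} {Q : Set q} (P? : Dec P) (Q? : Dec Q) → ⟦ P? ×-dec Q? ⟧ ≡ ⟦ P? ⟧ * ⟦ Q? ⟧
⟦×⟧ (yes _) (yes _) = refl
⟦×⟧ (yes _) (no _) = refl
⟦×⟧ (no _) Q? = refl

⟦≟⟧-sym : ∀ {k} (x y : Fin k) → ⟦ x ≟F y ⟧ ≡ ⟦ y ≟F x ⟧
⟦≟⟧-sym x y = ⟦⟧-iff (x ≟F y) (y ≟F x) sym sym

∑-mono : ∀ {k} {f g : Fin k → ℕ} → (∀ i → f i ≤ g i) → sum f ≤ sum g
∑-mono {zero} f≤g = z≤n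
∑-mono {suc k} f≤g = +-mono-≤ (f≤g zero) (∑-mono (λ i → f≤g (suc i)))

∑-zero : ∀ {k} (f : Fin k → ℕ) → (∀ i → f i ≡ 0) → sum f ≡ 0
∑-zero {k} f f≡0 = trans (sum-cong-≗ f≡0) (sum-replicate-zero k)

∑-*ˡ : ∀ {k} (c : ℕ) (f : Fin k → ℕ) → sum (λ i → c * f i) ≡ c * sum f
∑-*ˡ {zero} c f = sym (*-zeroʳ c)
∑-*ˡ {suc k} c f =
  trans (cong (c * f zero +_) (∑-*ˡ c (λ i → f (suc i)))) (sym (*-distribˡ-+ c (f zero) _))

∑-*ʳ : ∀ {k} (f : Fin k → ℕ) (c : ℕ) → sum (λ i → f i * c) ≡ sum f * c
∑-*ʳ f c = trans (sum-cong-≗ (λ i → *-comm (f i) c)) (trans (∑-*ˡ c f) (*-comm c (sum f)))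

term≤∑ : ∀ {k} (f : Fin k → ℕ) (a : Fin k) → f a ≤ sum f
term≤∑ f zero = m≤m+n (f zero) _
term≤∑ f (suc a) = ≤-trans (term≤∑ (λ i → f (suc i)) a) (m≤n+m _ (f zero))

∑-δ : ∀ {k} (a : Fin k) (f : Fin k → ℕ) → sum (λ i → ⟦ i ≟F a ⟧ * f i) ≡ f a
∑-δ {suc k} zero f = trans
  (cong₂ _+_ (+-identityʳ (f zero)) (∑-zero _ (λ i → cong (_* f (suc i)) (⟦⟧-no (suc i ≟F zero) λ ()))))
  (+-identityʳ (f zero))
∑-δ {suc k} (suc a) f = trans
  (cong₂ _+_ (cong (_* f zero) (⟦⟧-no (zero ≟F suc a) λ ()))
    (sum-cong-≗ (λ i → cong (_* f (suc i)) (⟦⟧-iff (suc i ≟F suc a) (i ≟F a) Fin-suc-injective (cong suc)))))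
  (∑-δ a (λ i → f (suc i)))

∑-δ1 : ∀ {k} (a : Fin k) → sum (λ i → ⟦ i ≟F a ⟧) ≡ 1
∑-δ1 a = trans (sum-cong-≗ (λ i → sym (*-identityʳ ⟦ i ≟F a ⟧))) (∑-δ a (λ _ → 1))

∑-ones : ∀ k → sum {k} (λ _ → 1) ≡ k
∑-ones zero = refl
∑-ones (suc k) = cong suc (∑-ones k)

length-filter-tabulate : ∀ {A : Set} {P : A → Set} (P? : ∀ a → Dec (P a)) {k} (g : Fin k → A) →
                         length (filter P? (tabulate g)) ≡ sum (λ i → ⟦ P? (g i) ⟧)
length-filter-tabulate P? {zero} g = refl
length-filter-tabulate P? {suc k} g with P? (g zero)
... | yes _ = cong suc (length-filter-tabulate P? (λ i → g (suc i)))
... | no _ = length-filter-tabulate P? (λ i → g (suc i))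

∈ₛ-tail : ∀ {k x} (S : Subset k) v → ⟦ suc v ∈ₛ? (x Vec.∷ S) ⟧ ≡ ⟦ v ∈ₛ? S ⟧
∈ₛ-tail S v = ⟦⟧-iff (suc v ∈ₛ? _) (v ∈ₛ? S) (λ { (Vec.there v∈S) → v∈S }) Vec.there

size-as-sum : ∀ {k} (S : Subset k) → sum (λ v → ⟦ v ∈ₛ? S ⟧) ≡ ∣ S ∣
size-as-sum Vec.[] = refl
size-as-sum (inside Vec.∷ S) = cong suc (trans (sum-cong-≗ (∈ₛ-tail S)) (size-as-sum S))
size-as-sum (outside Vec.∷ S) = trans (sum-cong-≗ (∈ₛ-tail S)) (size-as-sum S)

module Optimum (_≼_ : ℕ → ℕ → Set) (_≼?_ : ∀ a b → Dec (a ≼ b))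
  (≼-refl : ∀ {a} → a ≼ a) (≼-trans : ∀ {a b c} → a ≼ b → b ≼ c → a ≼ c)
  (≼-flip : ∀ {a b} → ¬ a ≼ b → b ≼ a) where

  optimum : ∀ {k} (P : Fin k → Set) → (∀ x → Dec (P x)) → (h : Fin k → ℕ) →
            ∃ P → ∃ λ x → P x × (∀ y → P y → h x ≼ h y)
  optimum {suc k} P P? h ∃P with any? (λ i → P? (suc i))
  ... | no none = zero , P0 ∃P , λ { zero _ → ≼-refl ; (suc y) Py → ⊥-elim (none (y , Py)) }
    where P0 : ∃ P → P zero
          P0 (zero , Pz) = Pz
          P0 (suc y , Py) = ⊥-elim (none (y , Py))
  ... | yes some with optimum (λ i → P (suc i)) (λ i → P? (suc i)) (λ i → h (suc i)) some | P? zero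
  ...   | x , Px , best | no ¬P0 = suc x , Px , λ { zero P0 → ⊥-elim (¬P0 P0) ; (suc y) Py → best y Py }
  ...   | x , Px , best | yes P0 with h (suc x) ≼? h zero
  ...     | yes le = suc x , Px , λ { zero _ → le ; (suc y) Py → best y Py }
  ...     | no gt = zero , P0 , λ { zero _ → ≼-refl ; (suc y) Py → ≼-trans (≼-flip gt) (best y Py) }

argmin : ∀ {k} (P : Fin k → Set) → (∀ x → Dec (P x)) → (h : Fin k → ℕ) →
         ∃ P → ∃ λ x → P x × (∀ y → P y → h x ≤ h y)
argmin = Optimum.optimum _≤_ _≤?_ ≤-refl ≤-trans (λ a≰b → <⇒≤ (≰⇒> a≰b))

argmax : ∀ {k} (P : Fin k → Set) → (∀ x → Dec (P x)) → (h : Fin k → ℕ) →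
         ∃ P → ∃ λ x → P x × (∀ y → P y → h y ≤ h x)
argmax = Optimum.optimum (λ a b → b ≤ a) (λ a b → b ≤? a) ≤-refl (λ p q → ≤-trans q p)
                         (λ b≰a → <⇒≤ (≰⇒> b≰a))

linked-snoc : ∀ {A : Set} {R : A → A → Set} (xs : List A) (y z : A) →
              Linked R (xs ++ [ y ]) → R y z → Linked R ((xs ++ [ y ]) ++ [ z ])
linked-snoc [] y z l e = e ∷ [-]
linked-snoc (x ∷ []) y z (e′ ∷ l) e = e′ ∷ e ∷ [-]
linked-snoc (x ∷ x′ ∷ xs) y z (e′ ∷ l) e = e′ ∷ linked-snoc (x′ ∷ xs) y z l e

unique-snoc : ∀ {A : Set} (xs : List A) (z : A) → Unique xs → All (_≢ z) xs → Unique (xs ++ [ z ])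
unique-snoc [] z u a = [] ∷ []
unique-snoc (x ∷ xs) z (x∉ ∷ u) (x≢z ∷ a) = Allₚ.++⁺ x∉ (x≢z ∷ []) ∷ unique-snoc xs z u a

longer : ∀ {A : Set} (M : List A) x → 1 ≤ length M → 2 ≤ length (M ++ [ x ])
longer M x nonempty = subst (2 ≤_) (sym (length-++ M)) (+-monoˡ-≤ 1 nonempty)

record Rooting {m} (adj : Adj m) : Set where
  field
    root         : Fin m
    parent       : Fin m → Fin m
    depth        : Fin m → ℕ
    depth-root   : depth root ≡ 0
    depth-zero   : ∀ z → depth z ≡ 0 → z ≡ root
    parent-root  : parent root ≡ root
    parent-edge  : ∀ z → z ≢ root → E adj z (parent z)
    parent-depth : ∀ z → z ≢ root → suc (depth (parent z)) ≡ depth z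
    depth-edge   : ∀ a b → E adj a b → depth b ≤ suc (depth a)

E-sym : ∀ {m} {adj : Adj m} → (∀ i j → adj i j ≡ adj j i) → ∀ {a b} → E adj a b → E adj b a
E-sym symm {a} {b} e = trans (symm b a) e

-- Breadth-first search: the distance from a node r of a connected graph
-- with symmetric adjacency is the depth function of a rooting.
module BreadthFirst {m} (adj : Adj m) (symm : ∀ i j → adj i j ≡ adj j i)
                    (r : Fin m) (conn : ∀ z → Star (E adj) r z) where

  Near : ℕ → Fin m → Set
  Near zero z = z ≡ r
  Near (suc i) z = Near i z ⊎ ∃ λ w → E adj z w × Near i w

  near? : ∀ i z → Dec (Near i z)
  near? zero z = z ≟F r
  near? (suc i) z = near? i z ⊎-dec any? (λ w → (adj z w ≟B true) ×-dec near? i w)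

  path-near : ∀ {a z} → Star (E adj) a z → ∀ i → Near i a → ∃ λ N → Near N z
  path-near ε i near = i , near
  path-near (e ◅ s) i near = path-near s (suc i) (inj₂ (_ , E-sym symm e , near))

  radius : Fin m → ℕ
  radius z = proj₁ (path-near (conn z) 0 refl)

  least : ∀ z → ∃ λ (j : Fin (suc (radius z))) →
            Near (toℕ j) z × (∀ j′ → Near (toℕ j′) z → toℕ j ≤ toℕ j′)
  least z = argmin (λ j → Near (toℕ j) z) (λ j → near? (toℕ j) z) toℕ
    (fromℕ< (n<1+n (radius z)) ,
     subst (λ i → Near i z) (sym (toℕ-fromℕ< (n<1+n (radius z)))) (proj₂ (path-near (conn z) 0 refl)))

  depth : Fin m → ℕ
  depth z = toℕ (proj₁ (least z))

  near-depth : ∀ z → Near (depth z) z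
  near-depth z = proj₁ (proj₂ (least z))

  depth-min : ∀ i z → Near i z → depth z ≤ i
  depth-min i z near with i ≤? radius z
  ... | yes i≤N = subst (depth z ≤_) (toℕ-fromℕ< (s≤s i≤N))
        (proj₂ (proj₂ (least z)) (fromℕ< (s≤s i≤N)) (subst (λ i → Near i z) (sym (toℕ-fromℕ< (s≤s i≤N))) near))
  ... | no i≰N = ≤-trans (toℕ≤pred[n] (proj₁ (least z))) (<⇒≤ (≰⇒> i≰N))

  depth-root : depth r ≡ 0
  depth-root = n≤0⇒n≡0 (depth-min 0 r refl)

  depth-zero : ∀ z → depth z ≡ 0 → z ≡ r
  depth-zero z d≡0 = subst (λ i → Near i z) d≡0 (near-depth z)

  depth-edge : ∀ a b → E adj a b → depth b ≤ suc (depth a)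
  depth-edge a b e = depth-min (suc (depth a)) b (inj₂ (a , E-sym symm e , near-depth a))

  upward : ∀ z → z ≢ r → ∃ λ w → E adj z w × suc (depth w) ≡ depth z
  upward z z≢r with depth z in d≡ | near-depth z
  ... | zero | near = ⊥-elim (z≢r near)
  ... | suc i | inj₁ near = ⊥-elim (<-irrefl refl (subst (_≤ i) d≡ (depth-min i z near)))
  ... | suc i | inj₂ (w , e , near) =
        w , e , cong suc (≤-antisym (depth-min i w near) (≤-pred (subst (_≤ suc (depth w)) d≡ (depth-edge w z (E-sym symm e)))))

  parentBy : ∀ z → Dec (z ≡ r) → Fin m
  parentBy z (yes _) = r
  parentBy z (no z≢r) = proj₁ (upward z z≢r)

  parent : Fin m → Fin m
  parent z = parentBy z (z ≟F r)

  parent-spec : ∀ z → z ≢ r → E adj z (parent z) × suc (depth (parent z)) ≡ depth z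
  parent-spec z z≢r with z ≟F r
  ... | yes z≡r = ⊥-elim (z≢r z≡r)
  ... | no z≢r′ = proj₂ (upward z z≢r′)

  rooting : Rooting adj
  rooting = record
    { root = r ; parent = parent ; depth = depth
    ; depth-root = depth-root ; depth-zero = depth-zero
    ; parent-root = parent-root
    ; parent-edge = λ z z≢r → proj₁ (parent-spec z z≢r)
    ; parent-depth = λ z z≢r → proj₂ (parent-spec z z≢r)
    ; depth-edge = depth-edge }
    where
      parent-root : parent r ≡ r
      parent-root with r ≟F r
      ... | yes _ = refl
      ... | no r≢r = ⊥-elim (r≢r refl)

module Ancestry {m} {adj : Adj m} (ρ : Rooting adj) where
  open Rooting ρ

  depth-parent< : ∀ z → z ≢ root → depth (parent z) < depth z
  depth-parent< z z≢r = ≤-reflexive (parent-depth z z≢r)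

  depth-parent : ∀ z → depth (parent z) ≡ depth z ∸ 1
  depth-parent z with z ≟F root
  ... | yes refl = trans (cong depth parent-root) (trans depth-root (sym (cong (_∸ 1) depth-root)))
  ... | no z≢r = cong (_∸ 1) (parent-depth z z≢r)

  positive-depth : ∀ {z} → 0 < depth z → z ≢ root
  positive-depth 0<d refl = <-irrefl (sym depth-root) 0<d

  parent-edge-injective : ∀ y y′ → SameEdge (y , parent y) (y′ , parent y′) → y ≡ y′
  parent-edge-injective y y′ (inj₁ (y≡y′ , _)) = y≡y′
  parent-edge-injective y y′ (inj₂ (y≡py′ , py≡y′)) with y ≟F root | y′ ≟F root
  ... | yes y≡r | _ = trans y≡r (sym (trans (sym py≡y′) (trans (cong parent y≡r) parent-root)))
  ... | no _ | yes y′≡r = trans y≡py′ (trans (cong parent y′≡r) (trans parent-root (sym y′≡r)))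
  ... | no y≢r | no y′≢r = ⊥-elim (<-asym (lower y y′ y≢r py≡y′) (lower y′ y y′≢r (sym y≡py′)))
    where lower : ∀ u w → u ≢ root → parent u ≡ w → depth w < depth u
          lower u w u≢r refl = depth-parent< u u≢r

  depth-ind : ∀ {ℓ} (P : Fin m → Set ℓ) → (∀ z → (∀ w → depth w < depth z → P w) → P z) → ∀ z → P z
  depth-ind P step z = go (suc (depth z)) z ≤-refl
    where go : ∀ n z → depth z < n → P z
          go (suc n) z d<n = step z (λ w dw<dz → go n w (≤-trans dw<dz (≤-pred d<n)))

  -- The j-th ancestor of z (stopping at the root).
  up : ℕ → Fin m → Fin m
  up zero z = z
  up (suc j) z = parent (up j z)

  depth-up : ∀ j z → depth (up j z) ≡ depth z ∸ j
  depth-up zero z = refl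
  depth-up (suc j) z = begin
    depth (parent (up j z))  ≡⟨ depth-parent (up j z) ⟩
    depth (up j z) ∸ 1       ≡⟨ cong (_∸ 1) (depth-up j z) ⟩
    depth z ∸ j ∸ 1          ≡⟨ ∸-+-assoc (depth z) j 1 ⟩
    depth z ∸ (j + 1)        ≡⟨ cong (depth z ∸_) (+-comm j 1) ⟩
    depth z ∸ suc j          ∎
    where open ≡-Reasoning

  up-parent : ∀ j z → up j (parent z) ≡ up (suc j) z
  up-parent zero z = refl
  up-parent (suc j) z = cong parent (up-parent j z)

  -- x is an ancestor of z (z itself included).
  Ancestor : Fin m → Fin m → Set
  Ancestor x z = up (depth z ∸ depth x) z ≡ x

  ancestor? : ∀ x z → Dec (Ancestor x z)
  ancestor? x z = up (depth z ∸ depth x) z ≟F x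

  ancestor-refl : ∀ z → Ancestor z z
  ancestor-refl z rewrite n∸n≡0 (depth z) = refl

  ancestor-depth : ∀ {x z} → Ancestor x z → depth x ≤ depth z
  ancestor-depth {x} {z} a =
    subst (_≤ depth z) (trans (sym (depth-up (depth z ∸ depth x) z)) (cong depth a)) (m∸n≤m (depth z) (depth z ∸ depth x))

  root-ancestor : ∀ z → Ancestor root z
  root-ancestor z = subst (λ q → up (depth z ∸ q) z ≡ root) (sym depth-root)
                      (depth-zero _ (trans (depth-up (depth z) z) (n∸n≡0 (depth z))))

  proper-ancestor-depth : ∀ {x z} → Ancestor x z → x ≢ z → depth x < depth z
  proper-ancestor-depth {x} {z} a x≢z with m≤n⇒m<n∨m≡n (ancestor-depth a)
  ... | inj₁ lt = lt
  ... | inj₂ d≡ = ⊥-elim (x≢z (trans (sym a) (cong (λ q → up q z) (trans (cong (depth z ∸_) d≡) (n∸n≡0 (depth z))))))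

  ancestor-of-parent : ∀ {x z} → Ancestor x z → x ≢ z → z ≢ root × Ancestor x (parent z)
  ancestor-of-parent {x} {z} a x≢z = z≢r , trans (up-parent (depth (parent z) ∸ depth x) z)
      (trans (cong (λ q → up q z) (trans (sym (+-∸-assoc 1 dx≤dpz)) (cong (_∸ depth x) (parent-depth z z≢r)))) a)
    where
      x<z = proper-ancestor-depth a x≢z
      z≢r = positive-depth (≤-trans (s≤s z≤n) x<z)
      dx≤dpz : depth x ≤ depth (parent z)
      dx≤dpz = ≤-pred (subst (suc (depth x) ≤_) (sym (parent-depth z z≢r)) x<z)

  ancestor-from-parent : ∀ {x z} → Ancestor x (parent z) → z ≢ root → Ancestor x z
  ancestor-from-parent {x} {z} a z≢r =
    trans (cong (λ q → up q z) (trans (cong (_∸ depth x) (sym (parent-depth z z≢r))) (+-∸-assoc 1 (ancestor-depth a))))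
          (trans (sym (up-parent (depth (parent z) ∸ depth x) z)) a)

  parent-ancestor : ∀ {w z} → Ancestor w z → w ≢ root → Ancestor (parent w) z
  parent-ancestor {w} {z} a w≢r =
    trans (cong (λ q → up q z) (∸-suc (depth z) (depth (parent w)) dpw<dz))
          (cong parent (trans (cong (λ q → up (depth z ∸ q) z) (parent-depth w w≢r)) a))
    where
      dpw<dz : suc (depth (parent w)) ≤ depth z
      dpw<dz = subst (_≤ depth z) (sym (parent-depth w w≢r)) (ancestor-depth a)
      ∸-suc : ∀ a b → suc b ≤ a → a ∸ b ≡ suc (a ∸ suc b)
      ∸-suc (suc a) zero _ = refl
      ∸-suc (suc a) (suc b) (s≤s b<a) = ∸-suc a b b<a

  ancestor-unique : ∀ {w w′ z} → Ancestor w z → Ancestor w′ z → depth w ≡ depth w′ → w ≡ w′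
  ancestor-unique {w} {w′} {z} a a′ d≡ = trans (sym a) (trans (cong (λ q → up (depth z ∸ q) z) d≡) a′)

  Child : Fin m → Fin m → Set
  Child w x = w ≢ root × parent w ≡ x

  child? : ∀ w x → Dec (Child w x)
  child? w x = ¬? (w ≟F root) ×-dec (parent w ≟F x)

  children : Fin m → ℕ
  children x = sum (λ w → ⟦ child? w x ⟧)

  child-depth : ∀ {w x} → Child w x → suc (depth x) ≡ depth w
  child-depth (w≢r , refl) = parent-depth _ w≢r

  child-toward : ∀ z x → Ancestor x z → x ≢ z → ∃ λ w → Child w x × Ancestor w z
  child-toward = depth-ind _ λ z ih x a x≢z → step z ih x (ancestor-of-parent a x≢z)
    where
      step : ∀ z → (∀ w → depth w < depth z → ∀ x → Ancestor x w → x ≢ w → ∃ λ c → Child c x × Ancestor c w) →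
             ∀ x → z ≢ root × Ancestor x (parent z) → ∃ λ w → Child w x × Ancestor w z
      step z ih x (z≢r , a) with parent z ≟F x
      ... | yes pz≡x = z , (z≢r , pz≡x) , ancestor-refl z
      ... | no pz≢x with ih (parent z) (depth-parent< z z≢r) x a (pz≢x ∘ sym)
      ...   | w , c , a′ = w , c , ancestor-from-parent a′ z≢r

  ancestor-split : ∀ x z → ⟦ ancestor? x z ⟧ ≡ ⟦ x ≟F z ⟧ + sum (λ w → ⟦ child? w x ×-dec ancestor? w z ⟧)
  ancestor-split x z with x ≟F z
  ... | yes refl = trans (⟦⟧-yes (ancestor? x x) (ancestor-refl x))
                         (cong suc (sym (∑-zero _ (λ w → ⟦⟧-no _ (no-child-above w)))))
    where
      no-child-above : ∀ w → ¬ (Child w x × Ancestor w x)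
      no-child-above w (c , a) = <-irrefl refl (≤-trans (≤-reflexive (child-depth c)) (ancestor-depth a))
  ... | no x≢z with ancestor? x z
  ...   | yes a = sym (trans (sum-cong-≗ (λ w → ⟦⟧-iff (child? w x ×-dec ancestor? w z) (w ≟F w₀) same (λ { refl → c₀ , a₀ })))
                             (∑-δ1 w₀))
    where
      w₀ = proj₁ (child-toward z x a x≢z)
      c₀ = proj₁ (proj₂ (child-toward z x a x≢z))
      a₀ = proj₂ (proj₂ (child-toward z x a x≢z))
      same : ∀ {w} → Child w x × Ancestor w z → w ≡ w₀
      same (c , a′) = ancestor-unique a′ a₀ (trans (sym (child-depth c)) (child-depth c₀))
  ...   | no ¬a = sym (∑-zero (λ w → ⟦ child? w x ×-dec ancestor? w z ⟧) (λ w → ⟦⟧-no _ (inherit w)))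
    where
      inherit : ∀ w → ¬ (Child w x × Ancestor w z)
      inherit w ((w≢r , pw≡x) , a′) = ¬a (subst (λ q → Ancestor q z) pw≡x (parent-ancestor a′ w≢r))

-- In a rooted graph with symmetric adjacency every child is a neighbour,
-- and so is the parent of a non-root node; hence the number of children
-- is at most the degree, and at most the degree minus one off the root.
module Branching {m} {adj : Adj m} (symm : ∀ i j → adj i j ≡ adj j i) (ρ : Rooting adj) where
  open Rooting ρ
  open Ancestry ρ

  degree-as-sum : ∀ x → degree adj x ≡ sum (λ w → ⟦ T? (adj x w) ⟧)
  degree-as-sum x = length-filter-tabulate (λ w → T? (adj x w)) (λ w → w)

  neighbour : ∀ {x w} → E adj x w → T (adj x w)
  neighbour e = subst T (sym e) tt

  child-neighbour : ∀ {w x} → Child w x → T (adj x w)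
  child-neighbour {w} (w≢r , refl) = neighbour (E-sym symm (parent-edge w w≢r))

  children≤degree : ∀ x → children x ≤ degree adj x
  children≤degree x = subst (children x ≤_) (sym (degree-as-sum x))
    (∑-mono (λ w → ⟦⟧-mono (child? w x) (T? (adj x w)) child-neighbour))

  children<degree : ∀ x → x ≢ root → children x < degree adj x
  children<degree x x≢r = begin
    suc (children x)                                           ≡⟨ +-comm 1 (children x) ⟩
    children x + 1                                             ≡⟨ cong (children x +_) (sym (∑-δ1 (parent x))) ⟩
    children x + sum (λ w → ⟦ w ≟F parent x ⟧)                 ≡⟨ sym (∑-distrib-+ (λ w → ⟦ child? w x ⟧) _) ⟩
    sum (λ w → ⟦ child? w x ⟧ + ⟦ w ≟F parent x ⟧)             ≤⟨ ∑-mono (λ w → pointwise w (child? w x) (w ≟F parent x)) ⟩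
    sum (λ w → ⟦ T? (adj x w) ⟧)                              ≡⟨ sym (degree-as-sum x) ⟩
    degree adj x                                               ∎
    where
      open ≤-Reasoning
      pointwise : ∀ w (c : Dec (Child w x)) (e : Dec (w ≡ parent x)) → ⟦ c ⟧ + ⟦ e ⟧ ≤ ⟦ T? (adj x w) ⟧
      pointwise w (yes c) (yes refl) =
        ⊥-elim (<-asym (≤-reflexive (child-depth c)) (depth-parent< x x≢r))
      pointwise w (yes c) (no _) = ⟦⟧-mono (yes c) (T? (adj x w)) child-neighbour
      pointwise w (no _) (yes refl) = ≤-reflexive (sym (⟦⟧-yes (T? (adj x w)) (neighbour (parent-edge x x≢r))))
      pointwise w (no _) (no _) = z≤n

-- In a rooted tree every edge joins a node to its parent

module TreeEdges {m} {adj : Adj m} (simple : IsSimple adj) (acyclic : ¬ HasCycle adj)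
                 (ρ : Rooting adj) where
  open Rooting ρ
  open Ancestry ρ using (depth-parent<; positive-depth)

  flip : ∀ {a b} → E adj a b → E adj b a
  flip = E-sym (proj₁ simple)

  ≢-by-depth : ∀ {a b} → depth a ≢ depth b → a ≢ b
  ≢-by-depth d≢ refl = d≢ refl

  not-root : ∀ {u v} → depth u ≡ depth v → u ≢ v → u ≢ root
  not-root {u} {v} d≡ u≢v refl = u≢v (sym (depth-zero v (trans (sym d≡) depth-root)))

  parent-level : ∀ {u f} → u ≢ root → depth u ≡ suc f → depth (parent u) ≡ f
  parent-level {u} u≠r du = suc-injective (trans (parent-depth u u≠r) du)

  -- bridge f u v: the inner nodes of the path from u up to the lowest common
  -- ancestor of u and v and down to v (for u ≠ v, both of depth f).
  bridge : ℕ → Fin m → Fin m → List (Fin m)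
  bridge f u v with parent u ≟F parent v
  ... | yes _ = [ parent u ]
  bridge zero u v | no _ = []
  bridge (suc f) u v | no _ = parent u ∷ (bridge f (parent u) (parent v) ++ [ parent v ])

  IsBridge : ℕ → Fin m → Fin m → List (Fin m) → Set
  IsBridge f u v M = Linked (E adj) (u ∷ M ++ [ v ]) × Unique (u ∷ M ++ [ v ])
                   × All (λ w → depth w < f) M × 1 ≤ length M

  common-parent : ∀ f u v → depth u ≡ f → depth v ≡ f → u ≢ v → parent u ≡ parent v →
                  IsBridge f u v [ parent u ]
  common-parent f u v du dv u≢v pu≡pv =
      parent-edge u u≠r ∷ subst (λ q → E adj q v) (sym pu≡pv) (flip (parent-edge v v≠r)) ∷ [-]
    , (above u u≠r ∷ u≢v ∷ []) ∷ (above′ ∷ []) ∷ [] ∷ []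
    , subst (depth (parent u) <_) du (depth-parent< u u≠r) ∷ []
    , s≤s z≤n
    where
      u≠r = not-root (trans du (sym dv)) u≢v
      v≠r = not-root (trans dv (sym du)) (u≢v ∘ sym)
      above : ∀ z → z ≢ root → z ≢ parent z
      above z z≠r = ≢-by-depth (λ d≡ → <-irrefl (sym d≡) (depth-parent< z z≠r))
      above′ : parent u ≢ v
      above′ pu≡v = above v v≠r (trans (sym pu≡v) pu≡pv)

  climb : ∀ f u v → depth u ≡ suc f → depth v ≡ suc f → u ≢ v → ∀ M →
          IsBridge f (parent u) (parent v) M → IsBridge (suc f) u v (parent u ∷ (M ++ [ parent v ]))
  climb f u v du dv u≢v M (linked , unique , high , nonempty) =
      parent-edge u u≠r ∷ linked-snoc (parent u ∷ M) (parent v) v linked (flip (parent-edge v v≠r))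
    , Allₚ.++⁺ (All.map (λ w<f → ≢-by-depth (λ d≡ → <-irrefl refl (subst (_< suc f) (trans (sym d≡) du) w<f))) inner)
          (u≢v ∷ []) ∷ unique-snoc (parent u ∷ M ++ [ parent v ]) v unique
            (All.map (λ w<f → ≢-by-depth (λ d≡ → <-irrefl refl (subst (_< suc f) (trans d≡ dv) w<f))) inner)
    , inner
    , s≤s z≤n
    where
      u≠r = not-root (trans du (sym dv)) u≢v
      v≠r = not-root (trans dv (sym du)) (u≢v ∘ sym)
      inner : All (λ w → depth w < suc f) (parent u ∷ M ++ [ parent v ])
      inner = ≤-reflexive (cong suc (parent-level u≠r du))
            ∷ Allₚ.++⁺ (All.map m<n⇒m<1+n high) (≤-reflexive (cong suc (parent-level v≠r dv)) ∷ [])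

  bridge-ok : ∀ f u v → depth u ≡ f → depth v ≡ f → u ≢ v → IsBridge f u v (bridge f u v)
  bridge-ok f u v du dv u≢v with parent u ≟F parent v
  ... | yes pu≡pv = common-parent f u v du dv u≢v pu≡pv
  bridge-ok zero u v du dv u≢v | no _ = ⊥-elim (not-root (trans du (sym dv)) u≢v (depth-zero u du))
  bridge-ok (suc f) u v du dv u≢v | no pu≢pv =
    climb f u v du dv u≢v _ (bridge-ok f (parent u) (parent v)
      (parent-level (not-root (trans du (sym dv)) u≢v) du) (parent-level (not-root (trans dv (sym du)) (u≢v ∘ sym)) dv) pu≢pv)

  -- An edge between two distinct nodes of equal depth closes a cycle.
  no-level-edge : ∀ a b → E adj a b → depth a ≡ depth b → a ≢ b → ⊥
  no-level-edge a b e d≡ a≢b = close (bridge-ok (depth a) a b refl (sym d≡) a≢b)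
    where
      M = bridge (depth a) a b
      close : IsBridge (depth a) a b M → ⊥
      close (linked , unique , _ , nonempty) =
        acyclic (a , M ++ [ b ] , longer M b nonempty , unique , linked-snoc (a ∷ M) b a linked (flip e))

  -- An edge from a down to a node b whose parent is not a closes a cycle
  -- through the bridge between a and the parent of b.
  no-foreign-edge : ∀ a b → E adj a b → depth b ≡ suc (depth a) → parent b ≢ a → ⊥
  no-foreign-edge a b e db pb≢a = close (bridge-ok (depth a) a (parent b) refl dpb (pb≢a ∘ sym))
    where
      M = bridge (depth a) a (parent b)
      b≠r : b ≢ root
      b≠r = positive-depth (subst (0 <_) (sym db) (s≤s z≤n))
      dpb : depth (parent b) ≡ depth a
      dpb = parent-level b≠r db
      lower : ∀ w → depth w ≤ depth a → b ≢ w
      lower w dw = ≢-by-depth (λ d≡ → <-irrefl refl (≤-trans (s≤s dw) (≤-reflexive (trans (sym db) d≡))))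
      close : IsBridge (depth a) a (parent b) M → ⊥
      close (linked , unique , high , nonempty) =
        acyclic (b , a ∷ M ++ [ parent b ] , ≤-trans (longer M (parent b) nonempty) (n≤1+n _) ,
          (lower a ≤-refl ∷ Allₚ.++⁺ (All.map (lower _ ∘ <⇒≤) high) (lower (parent b) (≤-reflexive dpb) ∷ [])) ∷ unique ,
          flip e ∷ linked-snoc (a ∷ M) (parent b) b linked (flip (parent-edge b b≠r)))

  tree-edge : ∀ a b → E adj a b → (a ≢ root × parent a ≡ b) ⊎ (b ≢ root × parent b ≡ a)
  tree-edge a b e with <-cmp (depth a) (depth b)
  ... | tri≈ _ d≡ _ = ⊥-elim (no-level-edge a b e d≡ a≢b)
    where a≢b : a ≢ b
          a≢b refl with trans (sym e) (proj₂ simple a)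
          ... | ()
  ... | tri< a<b _ _ with parent b ≟F a
  ...   | yes pb≡a = inj₂ (positive-depth (≤-trans (s≤s z≤n) a<b) , pb≡a)
  ...   | no pb≢a = ⊥-elim (no-foreign-edge a b e (≤-antisym (depth-edge a b e) a<b) pb≢a)
  tree-edge a b e | tri> _ _ b<a with parent a ≟F b
  ...   | yes pa≡b = inj₁ (positive-depth (≤-trans (s≤s z≤n) b<a) , pa≡b)
  ...   | no pa≢b = ⊥-elim (no-foreign-edge b a (flip e) (≤-antisym (depth-edge b a (flip e)) b<a) pa≢b)

-- Cut sets and the heads of their pieces

-- A cut set X is a list of non-root nodes; cutting the edges z–parent z
-- for z ∈ X splits the tree into pieces, and the head of the piece
-- containing z is its nearest ancestor in X, or the root if there is none.
module Heads {m} {adj : Adj m} (ρ : Rooting adj) where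
  open Rooting ρ
  open Ancestry ρ
  open DecMembership (_≟F_ {m}) using (_∈?_)

  headWithin : List (Fin m) → ℕ → Fin m → Fin m
  headWithin X f z with z ∈? X
  ... | yes _ = z
  headWithin X zero z | no _ = root
  headWithin X (suc f) z | no _ = headWithin X f (parent z)

  head : List (Fin m) → Fin m → Fin m
  head X z = headWithin X (depth z) z

  head-member : ∀ X z → z ∈ X → head X z ≡ z
  head-member X z z∈X with z ∈? X
  ... | yes _ = refl
  ... | no z∉X = ⊥-elim (z∉X z∈X)

  head-root : ∀ X → root ∉ X → head X root ≡ root
  head-root X r∉X = within (depth root)
    where
      within : ∀ f → headWithin X f root ≡ root
      within f with root ∈? X
      ... | yes r∈X = ⊥-elim (r∉X r∈X)
      within zero | no _ = refl
      within (suc f) | no _ = trans (cong (headWithin X f) parent-root) (within f)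

  head-parent : ∀ X z → z ∉ X → z ≢ root → head X z ≡ head X (parent z)
  head-parent X z z∉X z≢r = trans (cong (λ f → headWithin X f z) (sym (parent-depth z z≢r))) climb
    where
      climb : headWithin X (suc (depth (parent z))) z ≡ head X (parent z)
      climb with z ∈? X
      ... | yes z∈X = ⊥-elim (z∉X z∈X)
      ... | no _ = refl

  head-cases : ∀ X z → head X z ∈ X ⊎ head X z ≡ root
  head-cases X = depth-ind _ λ z ih → cases z ih (z ∈? X) (z ≟F root)
    where
      cases : ∀ z → (∀ w → depth w < depth z → head X w ∈ X ⊎ head X w ≡ root) →
              Dec (z ∈ X) → Dec (z ≡ root) → head X z ∈ X ⊎ head X z ≡ root
      cases z ih (yes z∈X) _ = inj₁ (subst (_∈ X) (sym (head-member X z z∈X)) z∈X)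
      cases z ih (no z∉X) (yes refl) = inj₂ (head-root X z∉X)
      cases z ih (no z∉X) (no z≢r) =
        subst (λ q → q ∈ X ⊎ q ≡ root) (sym (head-parent X z z∉X z≢r)) (ih (parent z) (depth-parent< z z≢r))

  head-ancestor : ∀ X z → Ancestor (head X z) z
  head-ancestor X = depth-ind _ λ z ih → cases z ih (z ∈? X) (z ≟F root)
    where
      cases : ∀ z → (∀ w → depth w < depth z → Ancestor (head X w) w) →
              Dec (z ∈ X) → Dec (z ≡ root) → Ancestor (head X z) z
      cases z ih (yes z∈X) _ = subst (λ q → Ancestor q z) (sym (head-member X z z∈X)) (ancestor-refl z)
      cases z ih (no z∉X) (yes refl) = subst (λ q → Ancestor q root) (sym (head-root X z∉X)) (ancestor-refl root)
      cases z ih (no z∉X) (no z≢r) = subst (λ q → Ancestor q z) (sym (head-parent X z z∉X z≢r))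
                                        (ancestor-from-parent (ih (parent z) (depth-parent< z z≢r)) z≢r)

  root-piece-upward : ∀ X → root ∉ X → ∀ z a → head X z ≡ root → Ancestor a z → head X a ≡ root
  root-piece-upward X r∉X = depth-ind _ λ z ih a hz a-z → climb z ih a hz a-z (a ≟F z)
    where
      climb : ∀ z → (∀ w → depth w < depth z → ∀ a → head X w ≡ root → Ancestor a w → head X a ≡ root) →
              ∀ a → head X z ≡ root → Ancestor a z → Dec (a ≡ z) → head X a ≡ root
      climb z ih a hz a-z (yes refl) = hz
      climb z ih a hz a-z (no a≢z) with ancestor-of-parent a-z a≢z
      ... | z≢r , a-pz = ih (parent z) (depth-parent< z z≢r) a (trans (sym (head-parent X z z∉X z≢r)) hz) a-pz
        where z∉X : z ∉ X
              z∉X z∈X = z≢r (trans (sym (head-member X z z∈X)) hz)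

  module Cut (X : List (Fin m)) (x : Fin m) (r∉X : root ∉ X) (x∉X : x ∉ X) (x≢r : x ≢ root)
             (hx : head X x ≡ root) where

    X′ : List (Fin m)
    X′ = x ∷ X

    Captured : Fin m → Set
    Captured z = Ancestor x z × head X z ≡ root

    captured? : ∀ z → Dec (Captured z)
    captured? z = ancestor? x z ×-dec (head X z ≟F root)

    not-cut : ∀ {z} → z ≢ x → z ∉ X → z ∉ X′
    not-cut z≢x z∉X (here z≡x) = z≢x z≡x
    not-cut z≢x z∉X (there z∈X) = z∉X z∈X

    HeadAfterCut : Fin m → Set
    HeadAfterCut z = (Captured z × head X′ z ≡ x) ⊎ (¬ Captured z × head X′ z ≡ head X z)

    head-after-cut : ∀ z → HeadAfterCut z
    head-after-cut = depth-ind _ λ z ih → cases z ih (z ≟F x) (z ∈? X) (z ≟F root)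
      where
        cases : ∀ z → (∀ w → depth w < depth z → HeadAfterCut w) →
                Dec (z ≡ x) → Dec (z ∈ X) → Dec (z ≡ root) → HeadAfterCut z
        cases z ih (yes refl) _ _ = inj₁ ((ancestor-refl x , hx) , head-member X′ x (here refl))
        cases z ih (no z≢x) (yes z∈X) _ =
          inj₂ ((λ (_ , hz) → r∉X (subst (_∈ X) (trans (sym (head-member X z z∈X)) hz) z∈X))
               , trans (head-member X′ z (there z∈X)) (sym (head-member X z z∈X)))
        cases z ih (no z≢x) (no z∉X) (yes refl) =
          inj₂ ((λ (a , _) → x≢r (depth-zero x (n≤0⇒n≡0 (subst (depth x ≤_) depth-root (ancestor-depth a)))))
               , trans (head-root X′ (not-cut z≢x z∉X)) (sym (head-root X z∉X)))
        cases z ih (no z≢x) (no z∉X) (no z≢r) with ih (parent z) (depth-parent< z z≢r)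
        ... | inj₁ ((a , h) , h′) =
              inj₁ ((ancestor-from-parent a z≢r , trans (head-parent X z z∉X z≢r) h)
                   , trans (head-parent X′ z (not-cut z≢x z∉X) z≢r) h′)
        ... | inj₂ (¬c , h′) =
              inj₂ ((λ (a , h) → ¬c (proj₂ (ancestor-of-parent a (z≢x ∘ sym)) , trans (sym (head-parent X z z∉X z≢r)) h))
                   , trans (head-parent X′ z (not-cut z≢x z∉X) z≢r) (trans h′ (sym (head-parent X z z∉X z≢r))))

    head≢x : ∀ z → head X z ≢ x
    head≢x z h≡x with head-cases X z
    ... | inj₁ h∈X = x∉X (subst (_∈ X) h≡x h∈X)
    ... | inj₂ h≡r = x≢r (trans (sym h≡x) h≡r)

    root-piece-after-cut : ∀ z → ⟦ head X z ≟F root ⟧ ≡ ⟦ head X′ z ≟F root ⟧ + ⟦ captured? z ⟧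
    root-piece-after-cut z with head-after-cut z
    ... | inj₁ (c , h′) rewrite ⟦⟧-yes (head X z ≟F root) (proj₂ c)
                              | ⟦⟧-no (head X′ z ≟F root) (λ q → x≢r (trans (sym h′) q))
                              | ⟦⟧-yes (captured? z) c = refl
    ... | inj₂ (¬c , h′) rewrite ⟦⟧-no (captured? z) ¬c | h′ = sym (+-identityʳ _)

    new-piece : ∀ z → ⟦ head X′ z ≟F x ⟧ ≡ ⟦ captured? z ⟧
    new-piece z with head-after-cut z
    ... | inj₁ (c , h′) = trans (⟦⟧-yes (head X′ z ≟F x) h′) (sym (⟦⟧-yes (captured? z) c))
    ... | inj₂ (¬c , h′) = trans (⟦⟧-no (head X′ z ≟F x) (λ q → head≢x z (trans (sym h′) q)))
                                 (sym (⟦⟧-no (captured? z) ¬c))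

    other-piece-after-cut : ∀ h → h ≢ x → h ≢ root → ∀ z → ⟦ head X′ z ≟F h ⟧ ≡ ⟦ head X z ≟F h ⟧
    other-piece-after-cut h h≢x h≢r z with head-after-cut z
    ... | inj₁ (c , h′) = trans (⟦⟧-no (head X′ z ≟F h) (λ q → h≢x (trans (sym q) h′)))
                                (sym (⟦⟧-no (head X z ≟F h) (λ q → h≢r (trans (sym q) (proj₂ c)))))
    ... | inj₂ (¬c , h′) rewrite h′ = refl

    parent-after-cut : head X′ (parent x) ≡ root
    parent-after-cut with head-after-cut (parent x)
    ... | inj₁ ((a , _) , _) = ⊥-elim (<-irrefl refl (≤-trans (depth-parent< x x≢r) (ancestor-depth a)))
    ... | inj₂ (_ , h′) = trans h′ (root-piece-upward X r∉X x (parent x) hx (parent-ancestor (ancestor-refl x) x≢r))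

    member-after-cut : ∀ y → ⟦ y ∈? X′ ⟧ ≡ ⟦ y ≟F x ⟧ + ⟦ y ∈? X ⟧
    member-after-cut y = split (y ≟F x)
      where
        split : (y≟x : Dec (y ≡ x)) → ⟦ y ∈? X′ ⟧ ≡ ⟦ y≟x ⟧ + ⟦ y ∈? X ⟧
        split (yes refl) = trans (⟦⟧-yes (y ∈? X′) (here refl)) (cong suc (sym (⟦⟧-no (y ∈? X) x∉X)))
        split (no y≢x) = ⟦⟧-iff (y ∈? X′) (y ∈? X) (λ { (here y≡x) → ⊥-elim (y≢x y≡x) ; (there y∈X) → y∈X }) there

-- Mass and boundary of pieces

-- Nodes carry weights c (vertices charged to the node) and β (adhesion to
-- the parent).
module Accounting {m} {adj : Adj m} (ρ : Rooting adj) (c β : Fin m → ℕ) where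
  open Rooting ρ
  open Ancestry ρ
  open Heads ρ
  open DecMembership (_≟F_ {m}) using (_∈?_)

  mass : List (Fin m) → Fin m → ℕ
  mass X h = sum (λ z → ⟦ head X z ≟F h ⟧ * c z)

  hanging : List (Fin m) → Fin m → Fin m → ℕ
  hanging X h y = ⟦ y ∈? X ⟧ * (⟦ head X (parent y) ≟F h ⟧ * β y)

  boundary : List (Fin m) → Fin m → ℕ
  boundary X h = sum (hanging X h)

  below : (Fin m → Fin m) → (Fin m → ℕ) → Fin m → ℕ
  below q f x = sum (λ y → ⟦ ancestor? x (q y) ⟧ * f y)

  below-split : ∀ q f x → below q f x ≡ sum (λ y → ⟦ x ≟F q y ⟧ * f y) + sum (λ w → ⟦ child? w x ⟧ * below q f w)
  below-split q f x = begin
      sum (λ y → ⟦ ancestor? x (q y) ⟧ * f y)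
    ≡⟨ sum-cong-≗ (λ y → trans (cong (_* f y) (ancestor-split x (q y)))
                              (trans (*-distribʳ-+ (f y) ⟦ x ≟F q y ⟧ _) (cong (⟦ x ≟F q y ⟧ * f y +_) (sym (∑-*ʳ (through y) (f y)))))) ⟩
      sum (λ y → ⟦ x ≟F q y ⟧ * f y + sum (λ w → through y w * f y))
    ≡⟨ ∑-distrib-+ (λ y → ⟦ x ≟F q y ⟧ * f y) _ ⟩
      sum (λ y → ⟦ x ≟F q y ⟧ * f y) + sum (λ y → sum (λ w → through y w * f y))
    ≡⟨ cong (sum (λ y → ⟦ x ≟F q y ⟧ * f y) +_) (trans (∑-comm (λ y w → through y w * f y)) (sum-cong-≗ per-child)) ⟩
      sum (λ y → ⟦ x ≟F q y ⟧ * f y) + sum (λ w → ⟦ child? w x ⟧ * below q f w)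
    ∎
    where
      open ≡-Reasoning
      through : Fin m → Fin m → ℕ
      through y w = ⟦ child? w x ×-dec ancestor? w (q y) ⟧
      per-child : ∀ w → sum (λ y → through y w * f y) ≡ ⟦ child? w x ⟧ * below q f w
      per-child w = trans (sum-cong-≗ (λ y → trans (cong (_* f y) (⟦×⟧ (child? w x) (ancestor? w (q y))))
                                                   (*-assoc ⟦ child? w x ⟧ _ (f y))))
                          (∑-*ˡ ⟦ child? w x ⟧ (λ y → ⟦ ancestor? w (q y) ⟧ * f y))

  below-root : ∀ q f → below q f root ≡ sum f
  below-root q f = sum-cong-≗ (λ y → trans (cong (_* f y) (⟦⟧-yes (ancestor? root (q y)) (root-ancestor (q y)))) (*-identityˡ (f y)))

  -- The mass and boundary of the part of the root piece inside the subtree of x.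
  liveMass : List (Fin m) → Fin m → ℕ
  liveMass X = below (λ z → z) (λ z → ⟦ head X z ≟F root ⟧ * c z)

  liveBoundary : List (Fin m) → Fin m → ℕ
  liveBoundary X = below parent (hanging X root)

  liveMass-split : ∀ X x → liveMass X x ≡ ⟦ head X x ≟F root ⟧ * c x + sum (λ w → ⟦ child? w x ⟧ * liveMass X w)
  liveMass-split X x = trans (below-split (λ z → z) _ x) (cong (_+ sum (λ w → ⟦ child? w x ⟧ * liveMass X w))
    (trans (sum-cong-≗ (λ y → cong (_* (⟦ head X y ≟F root ⟧ * c y)) (⟦≟⟧-sym x y)))
           (∑-δ x (λ y → ⟦ head X y ≟F root ⟧ * c y))))

  liveBoundary-children : ∀ X x → sum (λ w → ⟦ child? w x ⟧ * liveBoundary X w) ≤ liveBoundary X x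
  liveBoundary-children X x = subst (sum (λ w → ⟦ child? w x ⟧ * liveBoundary X w) ≤_)
    (sym (below-split parent (hanging X root) x)) (m≤n+m _ (sum (λ y → ⟦ x ≟F parent y ⟧ * hanging X root y)))

  liveMass-dead : ∀ X → root ∉ X → ∀ w → head X w ≢ root → liveMass X w ≡ 0
  liveMass-dead X r∉X w hw≢r = ∑-zero _ (λ z → vanish z (ancestor? w z) (head X z ≟F root))
    where
      vanish : ∀ z (a : Dec (Ancestor w z)) (h : Dec (head X z ≡ root)) → ⟦ a ⟧ * (⟦ h ⟧ * c z) ≡ 0
      vanish z (yes a) (yes h) = ⊥-elim (hw≢r (root-piece-upward X r∉X z w h a))
      vanish z (yes a) (no _) = refl
      vanish z (no _) h = refl

  light-children : ∀ X → root ∉ X → ∀ s x →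
    (∀ w → Child w x → head X w ≡ root → liveMass X w ≤ s + liveBoundary X w) →
    liveMass X x ≤ c x + s * children x + liveBoundary X x
  light-children X r∉X s x light = begin
      liveMass X x
    ≡⟨ liveMass-split X x ⟩
      ⟦ head X x ≟F root ⟧ * c x + sum (λ w → ⟦ child? w x ⟧ * liveMass X w)
    ≤⟨ +-mono-≤ (≤-trans (*-monoˡ-≤ (c x) (⟦⟧≤1 (head X x ≟F root))) (≤-reflexive (*-identityˡ (c x))))
                (∑-mono (λ w → per-child w (child? w x))) ⟩
      c x + sum (λ w → ⟦ child? w x ⟧ * (s + liveBoundary X w))
    ≡⟨ cong (c x +_) (trans (sum-cong-≗ (λ w → *-distribˡ-+ ⟦ child? w x ⟧ s (liveBoundary X w)))
                            (∑-distrib-+ (λ w → ⟦ child? w x ⟧ * s) _)) ⟩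
      c x + (sum (λ w → ⟦ child? w x ⟧ * s) + sum (λ w → ⟦ child? w x ⟧ * liveBoundary X w))
    ≡⟨ sym (+-assoc (c x) _ _) ⟩
      c x + sum (λ w → ⟦ child? w x ⟧ * s) + sum (λ w → ⟦ child? w x ⟧ * liveBoundary X w)
    ≤⟨ +-mono-≤ (≤-reflexive (cong (c x +_) (trans (∑-*ʳ (λ w → ⟦ child? w x ⟧) s) (*-comm _ s))))
                (liveBoundary-children X x) ⟩
      c x + s * children x + liveBoundary X x
    ∎
    where
      open ≤-Reasoning
      per-child : ∀ w (ch : Dec (Child w x)) → ⟦ ch ⟧ * liveMass X w ≤ ⟦ ch ⟧ * (s + liveBoundary X w)
      per-child w (no _) = z≤n
      per-child w (yes ch) with head X w ≟F root
      ... | yes hw = +-monoˡ-≤ 0 (light w ch hw)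
      ... | no hw = subst (λ u → u + 0 ≤ (s + liveBoundary X w) + 0) (sym (liveMass-dead X r∉X w hw)) z≤n

  module CutAccounting (X : List (Fin m)) (x : Fin m) (r∉X : root ∉ X) (x∉X : x ∉ X) (x≢r : x ≢ root)
                       (hx : head X x ≡ root) where
    open Cut X x r∉X x∉X x≢r hx

    -- The new cut node hangs from the root piece; the old ones from their old
    -- parents' new pieces.
    boundary-after-cut : ∀ h → boundary X′ h ≡
      ⟦ head X′ (parent x) ≟F h ⟧ * β x + sum (λ y → ⟦ y ∈? X ⟧ * (⟦ head X′ (parent y) ≟F h ⟧ * β y))
    boundary-after-cut h = begin
        sum (λ y → ⟦ y ∈? X′ ⟧ * weight y)
      ≡⟨ sum-cong-≗ (λ y → trans (cong (_* weight y) (member-after-cut y)) (*-distribʳ-+ (weight y) ⟦ y ≟F x ⟧ _)) ⟩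
        sum (λ y → ⟦ y ≟F x ⟧ * weight y + ⟦ y ∈? X ⟧ * weight y)
      ≡⟨ ∑-distrib-+ (λ y → ⟦ y ≟F x ⟧ * weight y) _ ⟩
        sum (λ y → ⟦ y ≟F x ⟧ * weight y) + sum (λ y → ⟦ y ∈? X ⟧ * weight y)
      ≡⟨ cong (_+ sum (λ y → ⟦ y ∈? X ⟧ * weight y)) (∑-δ x weight) ⟩
        weight x + sum (λ y → ⟦ y ∈? X ⟧ * weight y)
      ∎
      where
        open ≡-Reasoning
        weight : Fin m → ℕ
        weight y = ⟦ head X′ (parent y) ≟F h ⟧ * β y

    other-mass-after-cut : ∀ h → h ≢ x → h ≢ root → mass X′ h ≡ mass X h
    other-mass-after-cut h h≢x h≢r = sum-cong-≗ (λ z → cong (_* c z) (other-piece-after-cut h h≢x h≢r z))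

    other-boundary-after-cut : ∀ h → h ≢ x → h ≢ root → boundary X′ h ≡ boundary X h
    other-boundary-after-cut h h≢x h≢r = trans (boundary-after-cut h) (cong₂ _+_
      (cong (_* β x) (⟦⟧-no (head X′ (parent x) ≟F h) (λ q → h≢r (trans (sym q) parent-after-cut))))
      (sum-cong-≗ (λ y → cong (λ u → ⟦ y ∈? X ⟧ * (u * β y)) (other-piece-after-cut h h≢x h≢r (parent y)))))

    new-mass : mass X′ x ≡ liveMass X x
    new-mass = sum-cong-≗ (λ z → trans (cong (_* c z) (trans (new-piece z) (⟦×⟧ (ancestor? x z) (head X z ≟F root))))
                                       (*-assoc ⟦ ancestor? x z ⟧ _ (c z)))

    new-boundary : boundary X′ x ≡ liveBoundary X x
    new-boundary = begin
        boundary X′ x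
      ≡⟨ boundary-after-cut x ⟩
        ⟦ head X′ (parent x) ≟F x ⟧ * β x + sum old-hanging
      ≡⟨ cong (λ u → u * β x + sum old-hanging) (⟦⟧-no (head X′ (parent x) ≟F x) (λ q → x≢r (trans (sym q) parent-after-cut))) ⟩
        sum old-hanging
      ≡⟨ sum-cong-≗ captured-hanging ⟩
        liveBoundary X x
      ∎
      where
        open ≡-Reasoning
        old-hanging : Fin m → ℕ
        old-hanging y = ⟦ y ∈? X ⟧ * (⟦ head X′ (parent y) ≟F x ⟧ * β y)
        shuffle : ∀ a u e f → a * ((u * e) * f) ≡ u * (a * (e * f))
        shuffle = solve-∀
        captured-hanging : ∀ y → old-hanging y ≡ ⟦ ancestor? x (parent y) ⟧ * hanging X root y
        captured-hanging y = trans
          (cong (λ u → ⟦ y ∈? X ⟧ * (u * β y)) (trans (new-piece (parent y)) (⟦×⟧ (ancestor? x (parent y)) _)))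
          (shuffle ⟦ y ∈? X ⟧ ⟦ ancestor? x (parent y) ⟧ ⟦ head X (parent y) ≟F root ⟧ (β y))

    root-mass-after-cut : mass X root ≡ mass X′ root + liveMass X x
    root-mass-after-cut = trans
      (sum-cong-≗ (λ z → trans (cong (_* c z) (root-piece-after-cut z)) (trans (*-distribʳ-+ (c z) ⟦ head X′ z ≟F root ⟧ _)
        (cong (⟦ head X′ z ≟F root ⟧ * c z +_) (trans (cong (_* c z) (⟦×⟧ (ancestor? x z) (head X z ≟F root)))
                                                      (*-assoc ⟦ ancestor? x z ⟧ _ (c z)))))))
      (∑-distrib-+ (λ z → ⟦ head X′ z ≟F root ⟧ * c z) _)

    root-hanging-after-cut : ∀ y → hanging X root y ≡
      ⟦ y ∈? X ⟧ * (⟦ head X′ (parent y) ≟F root ⟧ * β y) + ⟦ ancestor? x (parent y) ⟧ * hanging X root y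
    root-hanging-after-cut y =
      trans (cong (λ u → ⟦ y ∈? X ⟧ * (u * β y)) (root-piece-after-cut (parent y)))
            (trans (cong (λ u → ⟦ y ∈? X ⟧ * ((⟦ head X′ (parent y) ≟F root ⟧ + u) * β y))
                         (⟦×⟧ (ancestor? x (parent y)) (head X (parent y) ≟F root)))
                   (split ⟦ y ∈? X ⟧ ⟦ head X′ (parent y) ≟F root ⟧ ⟦ ancestor? x (parent y) ⟧ ⟦ head X (parent y) ≟F root ⟧ (β y)))
      where split : ∀ a v u e f → a * ((v + u * e) * f) ≡ a * (v * f) + u * (a * (e * f))
            split = solve-∀

    root-boundary-after-cut : boundary X root + β x ≡ boundary X′ root + liveBoundary X x
    root-boundary-after-cut = begin
        boundary X root + β x
      ≡⟨ cong (_+ β x) (trans (sum-cong-≗ root-hanging-after-cut) (∑-distrib-+ stay _)) ⟩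
        (sum stay + liveBoundary X x) + β x
      ≡⟨ regroup (sum stay) (liveBoundary X x) (β x) ⟩
        (1 * β x + sum stay) + liveBoundary X x
      ≡⟨ cong (λ u → (u * β x + sum stay) + liveBoundary X x) (sym (⟦⟧-yes (head X′ (parent x) ≟F root) parent-after-cut)) ⟩
        (⟦ head X′ (parent x) ≟F root ⟧ * β x + sum stay) + liveBoundary X x
      ≡⟨ cong (_+ liveBoundary X x) (sym (boundary-after-cut root)) ⟩
        boundary X′ root + liveBoundary X x
      ∎
      where
        open ≡-Reasoning
        stay : Fin m → ℕ
        stay y = ⟦ y ∈? X ⟧ * (⟦ head X′ (parent y) ≟F root ⟧ * β y)
        regroup : ∀ a b e → (a + b) + e ≡ (1 * e + a) + b
        regroup = solve-∀

-- The greedy cutting procedure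

-- Target: ℓ cuts after which every piece has mass − boundary ≥ suc s.
-- One cut costs the root piece at most M = b + 2s.
module Greedy {m} {adj : Adj m} (ρ : Rooting adj) (c β : Fin m → ℕ) (b n ℓ s : ℕ) where
  open Rooting ρ
  open Ancestry ρ
  open Heads ρ
  open Accounting ρ c β

  M : ℕ
  M = b + 2 * s

  Heavy : List (Fin m) → Fin m → Set
  Heavy X h = suc s + boundary X h ≤ mass X h

  Candidate : List (Fin m) → Fin m → Set
  Candidate X x = head X x ≡ root × x ≢ root × suc s + liveBoundary X x ≤ liveMass X x

  candidate? : ∀ X x → Dec (Candidate X x)
  candidate? X x = (head X x ≟F root) ×-dec (¬? (x ≟F root) ×-dec (suc s + liveBoundary X x ≤? liveMass X x))

  -- After j cuts: j distinct non-root cut nodes heading heavy pieces, and a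
  -- root piece that lost at most j · M.
  Invariant : List (Fin m) → ℕ → Set
  Invariant X j = Unique X × root ∉ X × length X ≡ j × (∀ y → y ∈ X → Heavy X y)
                × n + boundary X root ≤ mass X root + j * M

  deepest-candidate : ∀ X → ∃ (Candidate X) → ∃ λ x → Candidate X x × (∀ w → Child w x → ¬ Candidate X w)
  deepest-candidate X some with argmax (Candidate X) (candidate? X) depth some
  ... | x , cand , deepest = x , cand , λ w ch cw → <-irrefl refl (≤-trans (≤-reflexive (child-depth ch)) (deepest w cw))

  no-candidate-children : ∀ X → root ∉ X → ∀ x → (∀ w → Child w x → ¬ Candidate X w) →
                          liveMass X x ≤ c x + s * children x + liveBoundary X x
  no-candidate-children X r∉X x none = light-children X r∉X s x light
    where light : ∀ w → Child w x → head X w ≡ root → liveMass X w ≤ s + liveBoundary X w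
          light w ch hw = ≤-pred (≰⇒> (λ heavy → none w ch (hw , proj₁ ch , heavy)))

  -- Bookkeeping of one cut: if the root piece changes by A = A′ + L in mass
  -- and B + β = B′ + F in boundary, with L + β ≤ M + F, it loses at most M.
  root-loss : ∀ {n A A′ B B′ L F β J} → n + B ≤ A + J → A ≡ A′ + L → B + β ≡ B′ + F →
              L + β ≤ M + F → n + B′ ≤ A′ + (M + J)
  root-loss {n} {A} {A′} {B} {B′} {L} {F} {β} {J} before mass≡ bnd≡ cost = +-cancelʳ-≤ F _ _ (begin
      n + B′ + F       ≡⟨ +-assoc n B′ F ⟩
      n + (B′ + F)     ≡⟨ cong (n +_) (sym bnd≡) ⟩
      n + (B + β)      ≡⟨ sym (+-assoc n B β) ⟩
      n + B + β        ≤⟨ +-monoˡ-≤ β before ⟩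
      A + J + β        ≡⟨ cong (λ a → a + J + β) mass≡ ⟩
      A′ + L + J + β   ≡⟨ regroup A′ L J β ⟩
      A′ + J + (L + β) ≤⟨ +-monoʳ-≤ (A′ + J) cost ⟩
      A′ + J + (M + F) ≡⟨ regroup′ A′ J M F ⟩
      A′ + (M + J) + F ∎)
    where
      open ≤-Reasoning
      regroup : ∀ a l j e → a + l + j + e ≡ a + j + (l + e)
      regroup = solve-∀
      regroup′ : ∀ a j k f → a + j + (k + f) ≡ a + (k + j) + f
      regroup′ = solve-∀

  module Procedure (small : ∀ z → z ≢ root → c z + β z ≤ b) (small-root : c root ≤ b) (total : sum c ≡ n)
                   (root-children : children root ≤ 3) (inner-children : ∀ x → x ≢ root → children x ≤ 2)
                   (room : ℓ * b + (2 * ℓ + 1) * s + 1 ≤ n) where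

    cut-cost : ∀ X → root ∉ X → ∀ x → x ≢ root → (∀ w → Child w x → ¬ Candidate X w) →
               liveMass X x + β x ≤ M + liveBoundary X x
    cut-cost X r∉X x x≢r none = begin
        liveMass X x + β x
      ≤⟨ +-monoˡ-≤ (β x) (no-candidate-children X r∉X x none) ⟩
        c x + s * children x + liveBoundary X x + β x
      ≤⟨ +-monoˡ-≤ (β x) (+-monoˡ-≤ (liveBoundary X x) (+-monoʳ-≤ (c x) (*-monoʳ-≤ s (inner-children x x≢r)))) ⟩
        c x + s * 2 + liveBoundary X x + β x
      ≡⟨ regroup (c x) (β x) s (liveBoundary X x) ⟩
        (c x + β x) + 2 * s + liveBoundary X x
      ≤⟨ +-monoˡ-≤ (liveBoundary X x) (+-monoˡ-≤ (2 * s) (small x x≢r)) ⟩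
        M + liveBoundary X x
      ∎
      where
        open ≤-Reasoning
        regroup : ∀ cx bx s F → cx + s * 2 + F + bx ≡ (cx + bx) + 2 * s + F
        regroup = solve-∀

    room-before : ∀ j → j < ℓ → b + 3 * s + j * M + 1 ≤ n
    room-before j j<ℓ = ≤-trans (≤-reflexive (cong (_+ 1) (sym (unfold j b s))))
      (≤-trans (+-monoˡ-≤ 1 (+-mono-≤ (*-monoˡ-≤ b j<ℓ) (*-monoˡ-≤ s (+-monoˡ-≤ 1 (*-monoʳ-≤ 2 j<ℓ))))) room)
      where unfold : ∀ j b s → suc j * b + (2 * suc j + 1) * s ≡ b + 3 * s + j * (b + 2 * s)
            unfold = solve-∀

    -- While fewer than ℓ cuts are made, some node is a candidate: otherwise
    -- the root piece would weigh at most b + 3s beyond its boundary.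
    candidate-exists : ∀ X j → j < ℓ → Invariant X j → ∃ (Candidate X)
    candidate-exists X j j<ℓ (_ , r∉X , _ , _ , root-piece) with any? (candidate? X)
    ... | yes some = some
    ... | no none = ⊥-elim (<-irrefl refl (≤-trans (≤-reflexive (+-comm 1 S)) (≤-trans (room-before j j<ℓ) n≤S)))
      where
        S = b + 3 * s + j * M
        open ≤-Reasoning
        root-mass : mass X root ≤ b + s * 3 + boundary X root
        root-mass = begin
          mass X root                                    ≡⟨ sym (below-root (λ z → z) _) ⟩
          liveMass X root                                ≤⟨ no-candidate-children X r∉X root (λ w _ cw → none (w , cw)) ⟩
          c root + s * children root + liveBoundary X root
            ≤⟨ +-mono-≤ (+-mono-≤ small-root (*-monoʳ-≤ s root-children)) (≤-reflexive (below-root parent _)) ⟩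
          b + s * 3 + boundary X root                    ∎
        regroup : ∀ b s B jM → b + s * 3 + B + jM ≡ (b + 3 * s + jM) + B
        regroup = solve-∀
        n≤S : n ≤ S
        n≤S = +-cancelʳ-≤ (boundary X root) n S (begin
          n + boundary X root                   ≤⟨ root-piece ⟩
          mass X root + j * M                   ≤⟨ +-monoˡ-≤ (j * M) root-mass ⟩
          b + s * 3 + boundary X root + j * M   ≡⟨ regroup b s (boundary X root) (j * M) ⟩
          S + boundary X root                   ∎)

    step : ∀ X j → j < ℓ → Invariant X j → ∃ λ X′ → Invariant X′ (suc j)
    step X j j<ℓ inv@(unique , r∉X , len , heavy , root-piece)
      with deepest-candidate X (candidate-exists X j j<ℓ inv)
    ... | x , (hx , x≢r , cand) , none = x ∷ X , unique′ , r∉X′ , cong suc len , heavy′ , root-piece′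
      where
        x∉X : x ∉ X
        x∉X x∈X = x≢r (trans (sym (head-member X x x∈X)) hx)
        open Cut X x r∉X x∉X x≢r hx
        open CutAccounting X x r∉X x∉X x≢r hx
        unique′ : Unique (x ∷ X)
        unique′ = All.tabulate (λ y∈X x≡y → x∉X (subst (_∈ X) (sym x≡y) y∈X)) ∷ unique
        r∉X′ : root ∉ (x ∷ X)
        r∉X′ (here r≡x) = x≢r (sym r≡x)
        r∉X′ (there r∈X) = r∉X r∈X
        heavy′ : ∀ y → y ∈ (x ∷ X) → Heavy (x ∷ X) y
        heavy′ y (here refl) = subst₂ (λ u v → suc s + u ≤ v) (sym new-boundary) (sym new-mass) cand
        heavy′ y (there y∈X) =
          subst₂ (λ u v → suc s + u ≤ v) (sym (other-boundary-after-cut y y≢x y≢r)) (sym (other-mass-after-cut y y≢x y≢r))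
                 (heavy y y∈X)
          where y≢x : y ≢ x
                y≢x y≡x = x∉X (subst (_∈ X) y≡x y∈X)
                y≢r : y ≢ root
                y≢r y≡r = r∉X (subst (_∈ X) y≡r y∈X)
        root-piece′ : n + boundary (x ∷ X) root ≤ mass (x ∷ X) root + suc j * M
        root-piece′ = root-loss {A′ = mass (x ∷ X) root} {B′ = boundary (x ∷ X) root}
                        root-piece root-mass-after-cut root-boundary-after-cut
                        (cut-cost X r∉X x x≢r none)

    initial : Invariant [] 0
    initial = [] , (λ ()) , refl , (λ y ()) , ≤-reflexive (cong₂ _+_ (sym all-mass) no-boundary)
      where
        all-mass : mass [] root ≡ n
        all-mass = trans (sum-cong-≗ (λ z → trans (cong (_* c z) (⟦⟧-yes (head [] z ≟F root) (in-root z))) (*-identityˡ (c z)))) total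
          where in-root : ∀ z → head [] z ≡ root
                in-root z with head-cases [] z
                ... | inj₂ h≡r = h≡r
        no-boundary : boundary [] root ≡ 0
        no-boundary = ∑-zero (hanging [] root) (λ y → refl)

    greedy : ∀ j → j ≤ ℓ → ∃ λ X → Invariant X j
    greedy zero _ = [] , initial
    greedy (suc j) j<ℓ with greedy j (≤-trans (n≤1+n j) j<ℓ)
    ... | X , inv = step X j j<ℓ inv

    -- After ℓ cuts all pieces are heavy: the root piece since it lost at most ℓ · M.
    all-heavy : ∀ X → Invariant X ℓ → ∀ z → Heavy X (head X z)
    all-heavy X (_ , _ , _ , heavy-cut , root-piece) z with head-cases X z
    ... | inj₁ h∈X = heavy-cut (head X z) h∈X
    ... | inj₂ h≡r = subst (Heavy X) (sym h≡r) (+-cancelˡ-≤ (ℓ * M) _ _ (begin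
        ℓ * M + (suc s + boundary X root)   ≡⟨ regroup (ℓ * M) (suc s) (boundary X root) ⟩
        (ℓ * M + suc s) + boundary X root   ≡⟨ cong (_+ boundary X root) (sym (expand ℓ b s)) ⟩
        (ℓ * b + (2 * ℓ + 1) * s + 1) + boundary X root  ≤⟨ +-monoˡ-≤ (boundary X root) room ⟩
        n + boundary X root                 ≤⟨ root-piece ⟩
        mass X root + ℓ * M                 ≡⟨ +-comm (mass X root) (ℓ * M) ⟩
        ℓ * M + mass X root                 ∎))
      where
        open ≤-Reasoning
        regroup : ∀ a e f → a + (e + f) ≡ (a + e) + f
        regroup = solve-∀
        expand : ∀ ℓ b s → ℓ * b + (2 * ℓ + 1) * s + 1 ≡ ℓ * (b + 2 * s) + suc s
        expand = solve-∀

-- Charging the vertices of G to the nodes of T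

-- Each vertex v is charged to its top node: a node of least depth whose
-- bag contains v.  charge z counts the vertices charged to z, adhesion z
-- the vertices shared by the bags of z and its parent.
module Charging {n m} {adj : Adj m} (ρ : Rooting adj) (B : Fin m → Subset n)
                (covered : ∀ v → ∃ λ z → v ∈ₛ B z) where
  open Rooting ρ

  top-spec : ∀ v → ∃ λ z → v ∈ₛ B z × (∀ y → v ∈ₛ B y → depth z ≤ depth y)
  top-spec v = argmin (λ z → v ∈ₛ B z) (λ z → v ∈ₛ? B z) depth (covered v)

  top : Fin n → Fin m
  top v = proj₁ (top-spec v)

  top-in : ∀ v → v ∈ₛ B (top v)
  top-in v = proj₁ (proj₂ (top-spec v))

  top-highest : ∀ v y → v ∈ₛ B y → depth (top v) ≤ depth y
  top-highest v = proj₂ (proj₂ (top-spec v))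

  InAdhesion : Fin m → Fin n → Set
  InAdhesion y v = v ∈ₛ B y × v ∈ₛ B (parent y)

  inAdhesion? : ∀ y v → Dec (InAdhesion y v)
  inAdhesion? y v = (v ∈ₛ? B y) ×-dec (v ∈ₛ? B (parent y))

  charge : Fin m → ℕ
  charge z = sum (λ v → ⟦ top v ≟F z ⟧)

  adhesion : Fin m → ℕ
  adhesion y = sum (λ v → ⟦ inAdhesion? y v ⟧)

  -- A vertex charged to z ≠ root is not in the parent's bag, so charge and
  -- adhesion count disjoint parts of the bag of z.
  charge+adhesion : ∀ z → z ≢ root → charge z + adhesion z ≤ ∣ B z ∣
  charge+adhesion z z≢r = begin
      charge z + adhesion z
    ≡⟨ sym (∑-distrib-+ (λ v → ⟦ top v ≟F z ⟧) (λ v → ⟦ inAdhesion? z v ⟧)) ⟩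
      sum (λ v → ⟦ top v ≟F z ⟧ + ⟦ inAdhesion? z v ⟧)
    ≤⟨ ∑-mono (λ v → disjoint v (top v ≟F z) (inAdhesion? z v)) ⟩
      sum (λ v → ⟦ v ∈ₛ? B z ⟧)
    ≡⟨ size-as-sum (B z) ⟩
      ∣ B z ∣
    ∎
    where
      open ≤-Reasoning
      disjoint : ∀ v (t : Dec (top v ≡ z)) (a : Dec (InAdhesion z v)) → ⟦ t ⟧ + ⟦ a ⟧ ≤ ⟦ v ∈ₛ? B z ⟧
      disjoint v (yes refl) (yes (_ , v∈Bp)) =
        ⊥-elim (<-irrefl refl (≤-trans (s≤s (top-highest v (parent z) v∈Bp)) (≤-reflexive (parent-depth z z≢r))))
      disjoint v (yes refl) (no _) = ≤-reflexive (sym (⟦⟧-yes (v ∈ₛ? B z) (top-in v)))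
      disjoint v (no _) a = ⟦⟧-mono a (v ∈ₛ? B z) proj₁

  charge≤bag : ∀ z → charge z ≤ ∣ B z ∣
  charge≤bag z = ≤-trans (∑-mono (λ v → ⟦⟧-mono (top v ≟F z) (v ∈ₛ? B z) (λ t≡z → subst (λ q → v ∈ₛ B q) t≡z (top-in v))))
                         (≤-reflexive (size-as-sum (B z)))

  total-charge : sum charge ≡ n
  total-charge = trans (∑-comm (λ z v → ⟦ top v ≟F z ⟧))
    (trans (sum-cong-≗ (λ v → trans (sum-cong-≗ (λ z → ⟦≟⟧-sym (top v) z)) (∑-δ1 (top v)))) (∑-ones n))

-- The pieces of T − R and the vertices they own

module Pieces {n m} {adj : Adj m} (simple : IsSimple adj) (acyclic : ¬ HasCycle adj) (ρ : Rooting adj)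
              (B : Fin m → Subset n) (covered : ∀ v → ∃ λ z → v ∈ₛ B z)
              (bag-connected : ∀ v z z′ → v ∈ₛ B z → v ∈ₛ B z′ →
                               Star (λ x y → E adj x y × v ∈ₛ B x × v ∈ₛ B y) z z′)
              (X : List (Fin m)) (r∉X : Rooting.root ρ ∉ X) where
  open Rooting ρ
  open Ancestry ρ
  open TreeEdges simple acyclic ρ using (tree-edge)
  open Heads ρ
  open Charging ρ B covered
  open Accounting ρ charge adhesion
  open DecMembership (_≟F_ {m}) using (_∈?_)

  cutEdges : List (Fin m × Fin m)
  cutEdges = map (λ y → (y , parent y)) X

  cut-edge-set : ∀ ℓ → Unique X → length X ≡ ℓ → IsEdgeSetOfSize adj ℓ cutEdges
  cut-edge-set ℓ unique len =
      trans (length-map _ X) len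
    , Allₚ.map⁺ (All.tabulate (λ {y} y∈X → parent-edge y (λ y≡r → r∉X (subst (_∈ X) y≡r y∈X))))
    , AllPairsₚ.map⁺ (AllPairs.map (λ {y} {y′} y≢y′ same → y≢y′ (parent-edge-injective y y′ same)) unique)

  Kept : Fin m → Fin m → Set
  Kept = E-minus adj cutEdges

  kept-sym : ∀ {a b} → Kept a b → Kept b a
  kept-sym {a} {b} (e , uncut) = E-sym (proj₁ simple) e , uncut ∘ Any.map swap
    where swap : ∀ {e′} → SameEdge (b , a) e′ → SameEdge (a , b) e′
          swap (inj₁ (b≡ , a≡)) = inj₂ (a≡ , b≡)
          swap (inj₂ (b≡ , a≡)) = inj₁ (a≡ , b≡)

  kept-parent : ∀ z → z ∉ X → z ≢ root → Kept z (parent z)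
  kept-parent z z∉X z≢r = parent-edge z z≢r , λ cut → cut-member (find (Anyₚ.map⁻ cut))
    where cut-member : (∃ λ y → y ∈ X × SameEdge (z , parent z) (y , parent y)) → ⊥
          cut-member (y , y∈X , same) = z∉X (subst (_∈ X) (sym (parent-edge-injective z y same)) y∈X)

  to-head : ∀ z → Star Kept z (head X z)
  to-head = depth-ind _ λ z ih → climb z ih (z ∈? X) (z ≟F root)
    where
      climb : ∀ z → (∀ w → depth w < depth z → Star Kept w (head X w)) → Dec (z ∈ X) → Dec (z ≡ root) → Star Kept z (head X z)
      climb z ih (yes z∈X) _ = subst (Star Kept z) (sym (head-member X z z∈X)) ε
      climb z ih (no z∉X) (yes refl) = subst (Star Kept root) (sym (head-root X z∉X)) ε
      climb z ih (no z∉X) (no z≢r) = kept-parent z z∉X z≢r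
        ◅ subst (Star Kept (parent z)) (sym (head-parent X z z∉X z≢r)) (ih (parent z) (depth-parent< z z≢r))

  same-head : ∀ z z₀ → head X z₀ ≡ head X z → Star Kept z z₀
  same-head z z₀ h≡ = to-head z ◅◅ subst (λ q → Star Kept q z₀) h≡ (Star.reverse kept-sym (to-head z₀))

  Crossing : Fin n → Fin m → Set
  Crossing v y = y ∈ X × InAdhesion y v

  crossing? : ∀ v y → Dec (Crossing v y)
  crossing? v y = (y ∈? X) ×-dec inAdhesion? y v

  VertexStep : Fin n → Fin m → Fin m → Set
  VertexStep v a a′ = E adj a a′ × v ∈ₛ B a × v ∈ₛ B a′

  uncrossed-path : ∀ v → ¬ (∃ (Crossing v)) → ∀ {a a′} → Star (VertexStep v) a a′ → Star Kept a a′
  uncrossed-path v none = Star.map (λ { (e , va , va′) → e , λ cut → uncut va va′ (find (Anyₚ.map⁻ cut)) })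
    where
      uncut : ∀ {a a′} → v ∈ₛ B a → v ∈ₛ B a′ → ¬ ∃ λ y → y ∈ X × SameEdge (a , a′) (y , parent y)
      uncut va va′ (y , y∈X , inj₁ (refl , refl)) = none (y , y∈X , va , va′)
      uncut va va′ (y , y∈X , inj₂ (refl , refl)) = none (y , y∈X , va′ , va)

  -- A vertex crossing some cut edge crosses one hanging directly below the
  -- piece of its top node: walk from the top towards the crossing inside the
  -- bags of v; the head is unchanged until a cut edge is passed downwards,
  -- and no cut edge can be passed upwards since the top is highest.
  crossing-below-top : ∀ v y → Crossing v y → ∃ λ y′ → Crossing v y′ × head X (parent y′) ≡ head X (top v)
  crossing-below-top v y (y∈X , vy , vpy) = walk (top v) refl (bag-connected v (top v) (parent y) (top-in v) vpy)
    where
      Goal = ∃ λ y′ → Crossing v y′ × head X (parent y′) ≡ head X (top v)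
      walk : ∀ a → head X a ≡ head X (top v) → Star (VertexStep v) a (parent y) → Goal
      walk a ha ε = y , (y∈X , vy , vpy) , ha
      walk a ha (_◅_ {j = a′} (e , va , va′) rest) = move (tree-edge a a′ e) (a ∈? X) (a′ ∈? X)
        where
          move : (a ≢ root × parent a ≡ a′) ⊎ (a′ ≢ root × parent a′ ≡ a) → Dec (a ∈ X) → Dec (a′ ∈ X) → Goal
          move (inj₁ (a≢r , refl)) (yes a∈X) _ = ⊥-elim (<-irrefl refl (begin-strict
              depth (parent a) <⟨ depth-parent< a a≢r ⟩
              depth a          ≡⟨ cong depth (sym (trans (sym ha) (head-member X a a∈X))) ⟩
              depth (head X (top v)) ≤⟨ ancestor-depth (head-ancestor X (top v)) ⟩
              depth (top v)    ≤⟨ top-highest v (parent a) va′ ⟩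
              depth (parent a) ∎))
            where open ≤-Reasoning
          move (inj₁ (a≢r , refl)) (no a∉X) _ = walk a′ (trans (sym (head-parent X a a∉X a≢r)) ha) rest
          move (inj₂ (a′≢r , refl)) _ (yes a′∈X) = a′ , (a′∈X , va′ , va) , ha
          move (inj₂ (a′≢r , refl)) _ (no a′∉X) = walk a′ (trans (head-parent X a′ a′∉X a′≢r) ha) rest

  module Piece (z : Fin m) where
    h = head X z

    Owned : Fin n → Set
    Owned v = (∃ λ z₀ → v ∈ₛ B z₀ × head X z₀ ≡ h) × ¬ ∃ (Crossing v)

    owned? : ∀ v → Dec (Owned v)
    owned? v = any? (λ z₀ → (v ∈ₛ? B z₀) ×-dec (head X z₀ ≟F h)) ×-dec ¬? (any? (crossing? v))

    owned-in-piece : ∀ v → Owned v → InGQ B (InComponent adj cutEdges z) v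
    owned-in-piece v ((z₀ , v∈z₀ , hz₀) , none) =
      (z₀ , same-head z z₀ hz₀ , v∈z₀) ,
      λ z′ v∈z′ → same-head z z₀ hz₀ ◅◅ uncrossed-path v none (bag-connected v z₀ z′ v∈z₀ v∈z′)

    mass-by-vertices : mass X h ≡ sum (λ v → ⟦ head X (top v) ≟F h ⟧)
    mass-by-vertices = begin
        sum (λ z′ → ⟦ head X z′ ≟F h ⟧ * sum (λ v → ⟦ top v ≟F z′ ⟧))
      ≡⟨ sum-cong-≗ (λ z′ → sym (∑-*ˡ ⟦ head X z′ ≟F h ⟧ (λ v → ⟦ top v ≟F z′ ⟧))) ⟩
        sum (λ z′ → sum (λ v → ⟦ head X z′ ≟F h ⟧ * ⟦ top v ≟F z′ ⟧))
      ≡⟨ ∑-comm (λ z′ v → ⟦ head X z′ ≟F h ⟧ * ⟦ top v ≟F z′ ⟧) ⟩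
        sum (λ v → sum (λ z′ → ⟦ head X z′ ≟F h ⟧ * ⟦ top v ≟F z′ ⟧))
      ≡⟨ sum-cong-≗ (λ v → trans (sum-cong-≗ (λ z′ → trans (*-comm ⟦ head X z′ ≟F h ⟧ _)
                                                           (cong (_* ⟦ head X z′ ≟F h ⟧) (⟦≟⟧-sym (top v) z′))))
                                 (∑-δ (top v) (λ z′ → ⟦ head X z′ ≟F h ⟧))) ⟩
        sum (λ v → ⟦ head X (top v) ≟F h ⟧)
      ∎
      where open ≡-Reasoning

    hangs : Fin n → Fin m → ℕ
    hangs v y = ⟦ y ∈? X ⟧ * (⟦ head X (parent y) ≟F h ⟧ * ⟦ inAdhesion? y v ⟧)

    boundary-by-vertices : boundary X h ≡ sum (λ v → sum (hangs v))
    boundary-by-vertices = trans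
      (sum-cong-≗ (λ y → trans (cong (⟦ y ∈? X ⟧ *_) (sym (∑-*ˡ ⟦ head X (parent y) ≟F h ⟧ (λ v → ⟦ inAdhesion? y v ⟧))))
                               (sym (∑-*ˡ ⟦ y ∈? X ⟧ (λ v → ⟦ head X (parent y) ≟F h ⟧ * ⟦ inAdhesion? y v ⟧)))))
      (∑-comm (λ y v → hangs v y))

    charged-inside : ∀ v → ⟦ head X (top v) ≟F h ⟧ ≤ ⟦ owned? v ⟧ + sum (hangs v)
    charged-inside v = cases (owned? v) (head X (top v) ≟F h) (any? (crossing? v))
      where
        cases : (o : Dec (Owned v)) (t : Dec (head X (top v) ≡ h)) → Dec (∃ (Crossing v)) → ⟦ t ⟧ ≤ ⟦ o ⟧ + sum (hangs v)
        cases (yes _) t _ = ≤-trans (⟦⟧≤1 t) (m≤m+n 1 _)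
        cases (no _) (no _) _ = z≤n
        cases (no ¬o) (yes t) (no none) = ⊥-elim (¬o ((top v , top-in v , t) , none))
        cases (no ¬o) (yes t) (yes (y , cross)) with crossing-below-top v y cross
        ... | y′ , (y′∈X , v∈adh) , hy′ = ≤-trans (≤-reflexive (sym (cong₂ _*_ (⟦⟧-yes (y′ ∈? X) y′∈X)
                                   (cong₂ _*_ (⟦⟧-yes (head X (parent y′) ≟F h) (trans hy′ t)) (⟦⟧-yes (inAdhesion? y′ v) v∈adh)))))
                                 (term≤∑ (hangs v) y′)

    piece-size : ∀ k → k + boundary X h ≤ mass X h →
                 Σ (List (Fin n)) λ L → Unique L × All (InGQ B (InComponent adj cutEdges z)) L × k ≤ length L
    piece-size k heavy =
        filter owned? (allFin n)
      , Uniqueₚ.filter⁺ owned? (Uniqueₚ.allFin⁺ n)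
      , All.map (λ {v} → owned-in-piece v) (Allₚ.all-filter owned? (allFin n))
      , subst (k ≤_) (sym (length-filter-tabulate owned? (λ v → v))) (+-cancelʳ-≤ (boundary X h) k _ (begin
          k + boundary X h                                       ≤⟨ heavy ⟩
          mass X h                                               ≡⟨ mass-by-vertices ⟩
          sum (λ v → ⟦ head X (top v) ≟F h ⟧)                    ≤⟨ ∑-mono charged-inside ⟩
          sum (λ v → ⟦ owned? v ⟧ + sum (hangs v))                ≡⟨ ∑-distrib-+ (λ v → ⟦ owned? v ⟧) _ ⟩
          sum (λ v → ⟦ owned? v ⟧) + sum (λ v → sum (hangs v))    ≡⟨ cong (sum (λ v → ⟦ owned? v ⟧) +_) (sym boundary-by-vertices) ⟩
          sum (λ v → ⟦ owned? v ⟧) + boundary X h                ∎))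
      where open ≤-Reasoning

-- With s = ⌊(n − ℓb − 1)/(2ℓ+1)⌋ there is room for ℓ cuts of cost b + 2s
-- and pieces of size s + 1 reach (n − ℓb)/(2ℓ+1).
piece-size-target : ∀ ℓ b n → ℓ * b < n →
  ∃ λ s → ℓ * b + (2 * ℓ + 1) * s + 1 ≤ n × n ∸ ℓ * b ≤ (2 * ℓ + 1) * suc s
piece-size-target ℓ b n ℓb<n = s , room , enough
  where
    N = n ∸ suc (ℓ * b)
    D = suc (2 * ℓ)
    s = N / D
    n≡ : suc (ℓ * b) + N ≡ n
    n≡ = m+[n∸m]≡n ℓb<n
    D≡ : 2 * ℓ + 1 ≡ D
    D≡ = +-comm (2 * ℓ) 1
    low : D * s ≤ N
    low = subst (_≤ N) (*-comm s D) (m/n*n≤m N D)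
    high : N < D * suc s
    high = begin-strict
      N                 ≡⟨ m≡m%n+[m/n]*n N D ⟩
      N % D + s * D     <⟨ +-monoˡ-< (s * D) (m%n<n N D) ⟩
      D + s * D         ≡⟨ *-comm (suc s) D ⟩
      D * suc s         ∎
      where open ≤-Reasoning
    room : ℓ * b + (2 * ℓ + 1) * s + 1 ≤ n
    room = begin
      ℓ * b + (2 * ℓ + 1) * s + 1   ≡⟨ cong (λ d → ℓ * b + d * s + 1) D≡ ⟩
      ℓ * b + D * s + 1             ≡⟨ +-comm (ℓ * b + D * s) 1 ⟩
      suc (ℓ * b + D * s)           ≤⟨ s≤s (+-monoʳ-≤ (ℓ * b) low) ⟩
      suc (ℓ * b) + N               ≡⟨ n≡ ⟩
      n                             ∎
      where open ≤-Reasoning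
    enough : n ∸ ℓ * b ≤ (2 * ℓ + 1) * suc s
    enough = begin
      n ∸ ℓ * b                   ≡⟨ cong (_∸ ℓ * b) (sym (trans (+-suc (ℓ * b) N) n≡)) ⟩
      ℓ * b + suc N ∸ ℓ * b       ≡⟨ m+n∸m≡n (ℓ * b) (suc N) ⟩
      suc N                       ≤⟨ high ⟩
      D * suc s                   ≡⟨ cong (_* suc s) (sym D≡) ⟩
      (2 * ℓ + 1) * suc s         ∎
      where open ≤-Reasoning

more-than-ℓb : ∀ ℓ b n → 1 ≤ b → (3 * ℓ + 1) * b ≤ n → ℓ * b < n
more-than-ℓb ℓ b n 1≤b n≥ = begin-strict
  ℓ * b            <⟨ m<m+n (ℓ * b) 1≤b ⟩
  ℓ * b + b        ≡⟨ factor ℓ b ⟩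
  (ℓ + 1) * b      ≤⟨ *-monoˡ-≤ b (+-monoˡ-≤ 1 (m≤n*m ℓ 3)) ⟩
  (3 * ℓ + 1) * b  ≤⟨ n≥ ⟩
  n                ∎
  where
    open ≤-Reasoning
    factor : ∀ ℓ b → ℓ * b + b ≡ (ℓ + 1) * b
    factor = solve-∀

BalancedCut : ∀ {n m} → ℕ → ℕ → Adj m → (Fin m → Subset n) → Set
BalancedCut {n} {m} ℓ b adj B = Σ (List (Fin m × Fin m)) λ R → IsEdgeSetOfSize adj ℓ R ×
  (∀ z → AtLeastVerts B (InComponent adj R z) (λ k → n ∸ ℓ * b ≤ (2 * ℓ + 1) * k))

balanced-cut : ∀ {n m} {adj : Adj m} (ℓ b : ℕ) → IsSimple adj → ¬ HasCycle adj → (ρ : Rooting adj) →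
  (B : Fin m → Subset n) → (∀ v → ∃ λ z → v ∈ₛ B z) →
  (∀ v z z′ → v ∈ₛ B z → v ∈ₛ B z′ → Star (λ x y → E adj x y × v ∈ₛ B x × v ∈ₛ B y) z z′) →
  (∀ z → degree adj z ≤ 3) → (∀ z → ∣ B z ∣ ≤ b) → ℓ * b < n → BalancedCut ℓ b adj B
balanced-cut {n} {m} {adj} ℓ b simple acyclic ρ B covered bag-connected deg bag ℓb<n =
  with-size (piece-size-target ℓ b n ℓb<n)
  where
    open Rooting ρ using (root)
    open Branching (proj₁ simple) ρ
    open Charging ρ B covered

    with-size : ∃ (λ s → ℓ * b + (2 * ℓ + 1) * s + 1 ≤ n × n ∸ ℓ * b ≤ (2 * ℓ + 1) * suc s) → BalancedCut ℓ b adj B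
    with-size (s , room , enough) = cut (greedy ℓ ≤-refl)
      where
        open Greedy ρ charge adhesion b n ℓ s
        open Procedure (λ z z≢r → ≤-trans (charge+adhesion z z≢r) (bag z)) (≤-trans (charge≤bag root) (bag root))
                       total-charge (≤-trans (children≤degree root) (deg root))
                       (λ x x≢r → ≤-pred (≤-trans (children<degree x x≢r) (deg x))) room

        cut : ∃ (λ X → Invariant X ℓ) → BalancedCut ℓ b adj B
        cut (X , invariant@(unique , r∉X , len , _)) = cutEdges , cut-edge-set ℓ unique len , large-piece
          where
            open Pieces simple acyclic ρ B covered bag-connected X r∉X
            large-piece : ∀ z → AtLeastVerts B (InComponent adj cutEdges z) (λ k → n ∸ ℓ * b ≤ (2 * ℓ + 1) * k)
            large-piece z with Piece.piece-size z (suc s) (all-heavy X invariant z)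
            ... | L , distinct , owned , size = L , distinct , owned , ≤-trans enough (*-monoʳ-≤ (2 * ℓ + 1) size)

lemma2p1 : (ℓ b n m : ℕ) → 2 ≤ b → (3 * ℓ + 1) * b ≤ n →
    (G : Multigraph n) (adj : Adj m) (B : Fin m → Subset n) →
    IsTreeDecomposition G adj B →
    (∀ (z : Fin m) → degree adj z ≤ 3) →
    (∀ (z : Fin m) → ∣ B z ∣ ≤ b) →
    Σ (List (Fin m × Fin m)) λ R → IsEdgeSetOfSize adj ℓ R ×
      (∀ (z : Fin m) → AtLeastVerts B (InComponent adj R z)
                          (λ k → n ∸ ℓ * b ≤ (2 * ℓ + 1) * k))
lemma2p1 ℓ b n _ 2≤b n≥ _ adj B ((1≤m , simple , connected , acyclic) , covered , _ , bag-connected) deg bag =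
  balanced-cut ℓ b simple acyclic ρ B covered bag-connected deg bag (more-than-ℓb ℓ b n (≤-trans (s≤s z≤n) 2≤b) n≥)
  where
    ρ : Rooting adj
    ρ = BreadthFirst.rooting adj (proj₁ simple) (fromℕ< 1≤m) (connected (fromℕ< 1≤m))
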